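{- For a fixed finite nonempty set $I$ and a fixed linear order $\ell_0$ on $I$, the set \[ \bigl\{p_\gamma \mid \text{$\gamma$ is a cyclic order on $I$}\bigr\} \] is a linear basis of $\mathbf{Lie}[I]$.
   Context: Work over a field $\mathbb{F}$ of characteristic $0$. $\mathbf L$ is the Hopf monoid of linear orders ($\mathbf L[I]$ has basis the linear orders on $I$, product = concatenation, coproduct $\Delta_{S,T}(\ell)=\ell|_S\otimes\ell|_T$), and $\mathbf{Lie}=\mathcal P(\mathbf L)$ is its species of primitive elements ($\{x:\Delta(x)=1\otimes x+x\otimes1\}$), the species underlying the Lie operad; $\dim\mathbf{Lie}[I]=(|I|-1)!$. A cyclic order on $I$ is a class of linear orders modulo cyclic rotation. Write $\ell_0=i_1|i_2|\cdots|i_n$. Given a cyclic order $\gamma$ on $I$ with $|I|\geq 2$, let $S$ be the set of elements met traversing $\gamma$ from $i_1$ to $i_2$ (including $i_1$, excluding $i_2$) and $T=I\setminus S$; define recursively $p_\gamma:=[p_{\gamma|_S},p_{\gamma|_T}]=p_{\gamma|_S}\cdot p_{\gamma|_T}-p_{\gamma|_T}\cdot p_{\gamma|_S}\in\mathbf L[I]$ (product of $\mathbf L$), where $\gamma|_S,\gamma|_T$ are the induced cyclic orders and $p_{\gamma|_S},p_{\gamma|_T}$ are defined with respect to the restrictions of $\ell_0$; for a singleton, $p_{(a)}:=a\in\mathbf L[\{a\}]$. -}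

module Defs where

open import Level using (Level; _⊔_; suc)
open import Algebra.Bundles using (CommutativeRing)
open import Data.Nat as ℕ using (ℕ; zero) renaming (suc to sucℕ)
open import Data.Fin as Fin using (Fin)
open import Data.Bool using (Bool; true; false; not; if_then_else_)
open import Data.List as List
  using (List; []; _∷_; _++_; map; concatMap; filterᵇ; takeWhileᵇ; dropWhileᵇ; length; allFin; foldr)
open import Data.List.Properties using (≡-dec)
open import Data.List.Relation.Binary.Permutation.Propositional using (_↭_)
open import Data.List.Relation.Unary.All using (All)
open import Data.List.Relation.Unary.Unique.Propositional using (Unique)
open import Data.Product using (_×_; _,_; proj₁; proj₂; ∃)
open import Relation.Nullary using (¬_; yes; no; does)
open import Relation.Binary.PropositionalEquality using (_≡_)

record Field (c ℓ : Level) : Set (suc (c ⊔ ℓ)) where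
  field
    commutativeRing : CommutativeRing c ℓ
  open CommutativeRing commutativeRing public
  field
    0≉1     : ¬ (0# ≈ 1#)
    inverse : ∀ x → ¬ (x ≈ 0#) → ∃ λ y → x * y ≈ 1#

  fromℕ : ℕ → Carrier
  fromℕ zero       = 0#
  fromℕ (sucℕ k)   = 1# + fromℕ k

CharZero : ∀ {c ℓ} → Field c ℓ → Set ℓ
CharZero F = ∀ k → ¬ (fromℕ (sucℕ k) ≈ 0#)
  where open Field F

-- Combinatorics of words / linear orders on I = Fin n.
-- A linear order on Fin n is a list that is a permutation of allFin n.

module _ {n : ℕ} where

  _==_ : Fin n → Fin n → Bool
  i == j = does (i Fin.≟ j)

  elem : Fin n → List (Fin n) → Bool
  elem i []       = false
  elem i (j ∷ js) = if i == j then true else elem i js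

  restrict : List (Fin n) → List (Fin n) → List (Fin n)
  restrict ℓ S = filterᵇ (λ i → elem i S) ℓ

  restrictᵖ : List (Fin n) → (Fin n → Bool) → List (Fin n)
  restrictᵖ ℓ S = filterᵇ S ℓ

  rotateTo : Fin n → List (Fin n) → List (Fin n)
  rotateTo a γ = dropWhileᵇ (λ i → not (i == a)) γ ++ takeWhileᵇ (λ i → not (i == a)) γ

  _≟w_ : (u v : List (Fin n)) → Bool
  u ≟w v = does (≡-dec Fin._≟_ u v)

-- all permutations of a list (each linear order of the letters exactly once
-- when the letters are distinct)
insertions : ∀ {a} {A : Set a} → A → List A → List (List A)
insertions x []       = (x ∷ []) ∷ []
insertions x (y ∷ ys) = (x ∷ y ∷ ys) ∷ map (y ∷_) (insertions x ys)

perms : ∀ {a} {A : Set a} → List A → List (List A)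
perms []       = [] ∷ []
perms (x ∷ xs) = concatMap (insertions x) (perms xs)

module _ {c ℓ} (F : Field c ℓ) {n : ℕ} where
  open Field F

  -- An element of the ambient space: a coefficient for each word over Fin n.
  -- Elements of L[I] are those supported on linear orders of I.
  Vect : Set c
  Vect = List (Fin n) → Carrier

  Poly : Set c
  Poly = List (Carrier × List (Fin n))

  ⟦_⟧ : Poly → Vect
  ⟦ P ⟧ w = foldr (λ cu acc → (if proj₂ cu ≟w w then proj₁ cu else 0#) + acc) 0# P

  -- commutator in L: [P , Q] = P·Q − Q·P (concatenation product)
  bracket : Poly → Poly → Poly
  bracket P Q =
    concatMap (λ cu → map (λ dv → (proj₁ cu * proj₁ dv , proj₂ cu ++ proj₂ dv)) Q) P
    ++ concatMap (λ cu → map (λ dv → (- (proj₁ cu * proj₁ dv) , proj₂ dv ++ proj₂ cu)) Q) P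

  -- p_γ, computed with fuel (fuel = length γ suffices); ℓ₀ is the fixed linear
  -- order (only its restriction to the letters of γ is used), γ is any
  -- linear representative of the cyclic order.
  pFuel : ℕ → List (Fin n) → List (Fin n) → Poly
  pFuel _        ℓ₀ []            = []
  pFuel _        ℓ₀ (a ∷ [])      = (1# , a ∷ []) ∷ []
  pFuel zero     ℓ₀ (_ ∷ _ ∷ _)   = []
  pFuel (sucℕ k) ℓ₀ γ@(_ ∷ _ ∷ _) with restrict ℓ₀ γ
  ... | i₁ ∷ i₂ ∷ _ =
        let γ' = rotateTo i₁ γ
            S  = takeWhileᵇ (λ i → not (i == i₂)) γ'
            T  = dropWhileᵇ (λ i → not (i == i₂)) γ'
        in bracket (pFuel k (restrict ℓ₀ S) S) (pFuel k (restrict ℓ₀ T) T)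
  ... | _ = []

  p : List (Fin n) → List (Fin n) → Vect
  p ℓ₀ γ = ⟦ pFuel (length γ) ℓ₀ γ ⟧

  InL : Vect → Set ℓ
  InL x = ∀ w → ¬ (w ↭ allFin n) → x w ≈ 0#

  -- coefficient of a ⊗ b in Δ_{S,T}(x), T the complement of S
  Δcoef : (Fin n → Bool) → Vect → List (Fin n) → List (Fin n) → Carrier
  Δcoef S x a b =
    foldr (λ w acc → (if (restrictᵖ w S ≟w a) then
                        (if (restrictᵖ w (λ i → not (S i)) ≟w b) then x w else 0#)
                      else 0#) + acc)
          0# (perms (allFin n))

  -- x ∈ Lie[I] = P(L)[I]: Δ_{S,T}(x) = 0 for every decomposition I = S ⊔ T
  -- with S, T nonempty (this is Δ(x) = 1⊗x + x⊗1)
  IsLie : Vect → Set ℓ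
  IsLie x = InL x ×
    (∀ (S : Fin n → Bool) → ∃ (λ i → S i ≡ true) → ∃ (λ i → S i ≡ false) →
       ∀ a b → Δcoef S x a b ≈ 0#)

  -- cyclic orders on I, represented by their unique linear representative
  -- starting at the first element i₁ of ℓ₀
  CycRep : List (Fin n) → List (Fin n) → Set
  CycRep ℓ₀ γ = (γ ↭ allFin n) × (List.take 1 γ ≡ List.take 1 ℓ₀)

  combo : List (Fin n) → List (Carrier × List (Fin n)) → Vect
  combo ℓ₀ cs w = foldr (λ cγ acc → proj₁ cγ * p ℓ₀ (proj₂ cγ) w + acc) 0# cs

  _≈V_ : Vect → Vect → Set ℓ
  x ≈V y = ∀ w → x w ≈ y w

  IsBasisOfLie : List (Fin n) → Set (c ⊔ ℓ)
  IsBasisOfLie ℓ₀ =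
    (∀ γ → CycRep ℓ₀ γ → IsLie (p ℓ₀ γ))
    × (∀ (cs : List (Carrier × List (Fin n))) →
         All (λ cγ → CycRep ℓ₀ (proj₂ cγ)) cs → Unique (map proj₂ cs) →
         combo ℓ₀ cs ≈V (λ _ → 0#) → All (λ cγ → proj₁ cγ ≈ 0#) cs)
    × (∀ x → IsLie x → ∃ λ (cs : List (Carrier × List (Fin n))) →
         All (λ cγ → CycRep ℓ₀ (proj₂ cγ)) cs × x ≈V combo ℓ₀ cs)

module Submission where

-- Elements of L[I] are coefficient functions on words; the product is
-- deconcatenation convolution and the coproduct coefficient Δ_{S,T}(x)(a , b) is
-- the shuffle sum Σ_{w ∈ a ⧢ b} x(w), so x is primitive iff its shuffle sums
-- over pairs of nonempty words vanish.

open import Defs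
open import Level using (Level)
open import Data.Nat as ℕ using (ℕ; zero; suc; _<_; _≤_; z≤n; s≤s)
import Data.Nat.Properties as NP
open import Data.Fin as Fin using (Fin)
open import Data.Bool as Bool using (Bool; true; false; not; if_then_else_; T?)
open import Data.Bool.Properties using (T-≡)
open import Data.List
  using (List; []; _∷_; _++_; map; concatMap; length; allFin; filter; filterᵇ; takeWhileᵇ; dropWhileᵇ; foldr)
import Data.List.Properties as LP
open import Data.List.Membership.Propositional using (_∈_; _∉_)
open import Data.List.Membership.Propositional.Properties
  using (∈-map⁺; ∈-map⁻; ∈-++⁺ˡ; ∈-++⁺ʳ; ∈-++⁻; ∈-∃++; ∈-allFin; ∈-filter⁺; ∈-filter⁻)
import Data.List.Membership.DecPropositional as DecMembership
open import Data.List.Relation.Unary.Any as Any using (here; there)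
open import Data.List.Relation.Unary.Any.Properties using (¬Any[])
open import Data.List.Relation.Unary.All as All using (All; []; _∷_)
open import Data.List.Relation.Unary.All.Properties using (¬Any⇒All¬; All¬⇒¬Any)
open import Data.List.Relation.Unary.AllPairs using ([]; _∷_)
open import Data.List.Relation.Unary.Unique.Propositional using (Unique)
import Data.List.Relation.Unary.Unique.Propositional.Properties as UP
open import Data.List.Relation.Binary.Permutation.Propositional as Perm
  using (_↭_; ↭-sym; ↭-trans; ↭-refl; ↭⇒↭ₛ)
open import Data.List.Relation.Binary.Permutation.Propositional.Properties
  using (∈-resp-↭; All-resp-↭; drop-mid; drop-∷; ↭-empty-inv; shift; ++-comm; ++⁺; ↭-length)
import Data.List.Relation.Binary.Permutation.Setoid.Properties as PermSetoid
open import Data.List.Relation.Binary.Sublist.Propositional as Sublist using (_⊆_; []; _∷_; _∷ʳ_)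
open import Data.List.Relation.Binary.Sublist.Propositional.Properties using (filter-⊆; ∷ˡ⁻)
open import Data.Product using (_×_; _,_; proj₁; proj₂; ∃)
open import Data.Sum using (_⊎_; inj₁; inj₂)
open import Data.Empty using (⊥; ⊥-elim)
open import Data.Unit using (⊤)
open import Data.Maybe using (nothing)
open import Function using (_∘_; Equivalence)
open import Relation.Nullary using (¬_; Dec; yes; no; ¬?)
open import Relation.Nullary.Decidable using (dec-true; dec-false)
open import Relation.Binary using (tri<; tri≈; tri>)
open import Relation.Binary.Definitions using (DecidableEquality)
open import Relation.Binary.PropositionalEquality as P using (_≡_; _≢_)
open import Tactic.RingSolver.Core.AlmostCommutativeRing using (fromCommutativeRing)
import Tactic.RingSolver.NonReflective as RingSolver
open import Tactic.RingSolver.Core.Expression using (_⊕_; _⊗_; ⊝_)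
import Algebra.Properties.Ring as RingProperties

module _ {a b} {A : Set a} {B : Set b} (f : A → List B) where

  ∈-concatMap⁻ : ∀ xs {y} → y ∈ concatMap f xs → ∃ λ x → x ∈ xs × y ∈ f x
  ∈-concatMap⁻ (x ∷ xs) m with ∈-++⁻ (f x) m
  ... | inj₁ m' = x , here P.refl , m'
  ... | inj₂ m' with ∈-concatMap⁻ xs m'
  ...   | z , zm , ym = z , there zm , ym

  ∈-concatMap⁺ : ∀ {xs x y} → x ∈ xs → y ∈ f x → y ∈ concatMap f xs
  ∈-concatMap⁺ {x' ∷ xs} (here P.refl) m = ∈-++⁺ˡ m
  ∈-concatMap⁺ {x' ∷ xs} (there xm) m = ∈-++⁺ʳ (f x') (∈-concatMap⁺ xm m)

  Unique-concatMap : ∀ (g : B → A) xs → Unique xs → (∀ x → x ∈ xs → Unique (f x)) →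
    (∀ x y → x ∈ xs → y ∈ f x → g y ≡ x) → Unique (concatMap f xs)
  Unique-concatMap g [] u uf gf = []
  Unique-concatMap g (x ∷ xs) (hx ∷ u) uf gf =
    UP.++⁺ (uf x (here P.refl))
      (Unique-concatMap g xs u (λ z m → uf z (there m)) (λ z y m → gf z y (there m)))
      λ { (m1 , m2) → let (z , zm , vm) = ∈-concatMap⁻ xs m2 in
          All¬⇒¬Any hx (P.subst (_∈ xs) (P.trans (P.sym (gf z _ (there zm) vm)) (gf x _ (here P.refl) m1)) zm) }

module _ {a} {A : Set a} where

  Unique-resp-↭ : ∀ {xs ys : List A} → xs ↭ ys → Unique xs → Unique ys
  Unique-resp-↭ p = PermSetoid.Unique-resp-↭ (P.setoid A) (↭⇒↭ₛ p)

  insertions-sound : ∀ (x : A) ys {w} → w ∈ insertions x ys → w ↭ x ∷ ys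
  insertions-sound x [] (here P.refl) = ↭-refl
  insertions-sound x (y ∷ ys) (here P.refl) = ↭-refl
  insertions-sound x (y ∷ ys) (there m) with ∈-map⁻ (y ∷_) m
  ... | w' , m' , P.refl = ↭-trans (Perm.prep y (insertions-sound x ys m')) (Perm.swap y x ↭-refl)

  insertions-complete : ∀ (x : A) w₁ w₂ → w₁ ++ x ∷ w₂ ∈ insertions x (w₁ ++ w₂)
  insertions-complete x [] [] = here P.refl
  insertions-complete x [] (y ∷ w₂) = here P.refl
  insertions-complete x (y ∷ w₁) w₂ = there (∈-map⁺ (y ∷_) (insertions-complete x w₁ w₂))

  perms-sound : ∀ (xs : List A) {w} → w ∈ perms xs → w ↭ xs
  perms-sound [] (here P.refl) = ↭-refl
  perms-sound (x ∷ xs) m with ∈-concatMap⁻ (insertions x) (perms xs) m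
  ... | v , vm , wm = ↭-trans (insertions-sound x v wm) (Perm.prep x (perms-sound xs vm))

  perms-complete : ∀ (xs : List A) {w} → w ↭ xs → w ∈ perms xs
  perms-complete [] p rewrite ↭-empty-inv p = here P.refl
  perms-complete (x ∷ xs) {w} p with ∈-∃++ (∈-resp-↭ (↭-sym p) (here P.refl))
  ... | w₁ , w₂ , P.refl =
    ∈-concatMap⁺ (insertions x) (perms-complete xs (drop-mid w₁ [] p)) (insertions-complete x w₁ w₂)

  module _ (_≟_ : DecidableEquality A) where

    delete : A → List A → List A
    delete x [] = []
    delete x (y ∷ ys) with x ≟ y
    ... | yes _ = delete x ys
    ... | no _ = y ∷ delete x ys

    delete-∉ : ∀ x ys → x ∉ ys → delete x ys ≡ ys
    delete-∉ x [] h = P.refl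
    delete-∉ x (y ∷ ys) h with x ≟ y
    ... | yes P.refl = ⊥-elim (h (here P.refl))
    ... | no _ = P.cong (y ∷_) (delete-∉ x ys (h ∘ there))

    delete-insertions : ∀ x ys {w} → x ∉ ys → w ∈ insertions x ys → delete x w ≡ ys
    delete-insertions x [] h (here P.refl) with x ≟ x
    ... | yes _ = P.refl
    ... | no ne = ⊥-elim (ne P.refl)
    delete-insertions x (y ∷ ys) h (here P.refl) with x ≟ x
    ... | yes _ = delete-∉ x (y ∷ ys) h
    ... | no ne = ⊥-elim (ne P.refl)
    delete-insertions x (y ∷ ys) h (there m) with ∈-map⁻ (y ∷_) m
    ... | w' , m' , P.refl with x ≟ y
    ...   | yes P.refl = ⊥-elim (h (here P.refl))
    ...   | no _ = P.cong (y ∷_) (delete-insertions x ys (h ∘ there) m')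

    Unique-insertions : ∀ (x : A) ys → x ∉ ys → Unique (insertions x ys)
    Unique-insertions x [] h = [] ∷ []
    Unique-insertions x (y ∷ ys) h =
      ¬Any⇒All¬ _ notFirst ∷ UP.map⁺ LP.∷-injectiveʳ (Unique-insertions x ys (h ∘ there))
      where
        notFirst : (x ∷ y ∷ ys) ∉ map (y ∷_) (insertions x ys)
        notFirst m with ∈-map⁻ (y ∷_) m
        ... | _ , _ , P.refl = h (here P.refl)

    Unique-perms : ∀ (xs : List A) → Unique xs → Unique (perms xs)
    Unique-perms [] u = [] ∷ []
    Unique-perms (x ∷ xs) (hx ∷ u) =
      Unique-concatMap (insertions x) (delete x) (perms xs) (Unique-perms xs u)
        (λ v m → Unique-insertions x v (x∉ m)) (λ v w vm m → delete-insertions x v (x∉ vm) m)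
      where
        x∉ : ∀ {v} → v ∈ perms xs → x ∉ v
        x∉ vm xm = All¬⇒¬Any hx (∈-resp-↭ (perms-sound xs vm) xm)

    _↭?_ : (w xs : List A) → Dec (w ↭ xs)
    w ↭? xs with DecMembership._∈?_ (LP.≡-dec _≟_) w (perms xs)
    ... | yes m = yes (perms-sound xs m)
    ... | no nm = no (λ p → nm (perms-complete xs p))

  ∈-delete⁺ : ∀ (xs : List A) {l ys v} → v ∈ xs ++ ys → v ∈ xs ++ l ∷ ys
  ∈-delete⁺ [] m = there m
  ∈-delete⁺ (x ∷ xs) (here e) = here e
  ∈-delete⁺ (x ∷ xs) (there m) = there (∈-delete⁺ xs m)

  ∈-delete⁻ : ∀ (xs : List A) {l ys v} → v ∈ xs ++ l ∷ ys → v ≢ l → v ∈ xs ++ ys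
  ∈-delete⁻ [] (here e) ne = ⊥-elim (ne e)
  ∈-delete⁻ [] (there m) ne = m
  ∈-delete⁻ (x ∷ xs) (here e) ne = here e
  ∈-delete⁻ (x ∷ xs) (there m) ne = there (∈-delete⁻ xs m ne)

  Unique-delete : ∀ (xs : List A) {l ys} → Unique (xs ++ l ∷ ys) → Unique (xs ++ ys) × l ∉ xs ++ ys
  Unique-delete [] (h ∷ u) = u , All¬⇒¬Any h
  Unique-delete (x ∷ xs) {l} (h ∷ u) with Unique-delete xs u
  ... | u' , l∉ = (¬Any⇒All¬ _ (λ m → All¬⇒¬Any h (∈-delete⁺ xs m)) ∷ u') , l∉'
    where
      l∉' : l ∉ x ∷ xs ++ _
      l∉' (here e) = All¬⇒¬Any h (P.subst (λ z → z ∈ xs ++ l ∷ _) e (∈-++⁺ʳ xs (here P.refl)))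
      l∉' (there m) = l∉ m

  Unique-++ˡ : ∀ (xs : List A) {ys} → Unique (xs ++ ys) → Unique xs
  Unique-++ˡ [] u = []
  Unique-++ˡ (x ∷ xs) (h ∷ u) = ¬Any⇒All¬ _ (λ m → All¬⇒¬Any h (∈-++⁺ˡ m)) ∷ Unique-++ˡ xs u

  Unique-++ʳ : ∀ (xs : List A) {ys} → Unique (xs ++ ys) → Unique ys
  Unique-++ʳ [] u = u
  Unique-++ʳ (x ∷ xs) (_ ∷ u) = Unique-++ʳ xs u

  Unique-++-disjoint : ∀ (xs : List A) {ys z} → Unique (xs ++ ys) → z ∈ xs → z ∉ ys
  Unique-++-disjoint (x ∷ xs) (h ∷ u) (here P.refl) m = All¬⇒¬Any h (∈-++⁺ʳ xs m)
  Unique-++-disjoint (x ∷ xs) (h ∷ u) (there zm) m = Unique-++-disjoint xs u zm m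

  prefix-unique : ∀ (s t u v : List A) → s ++ t ≡ u ++ v → length s ≡ length u → s ≡ u
  prefix-unique [] t [] v e l = P.refl
  prefix-unique (x ∷ s) t (y ∷ u) v e l with LP.∷-injective e
  ... | P.refl , e' = P.cong (x ∷_) (prefix-unique s t u v e' (NP.suc-injective l))

  takeWhile++dropWhile : ∀ (q : A → Bool) γ → takeWhileᵇ q γ ++ dropWhileᵇ q γ ≡ γ
  takeWhile++dropWhile q = LP.takeWhile++dropWhile (T? ∘ q)

  rotation-↭ : ∀ (q : A → Bool) γ → dropWhileᵇ q γ ++ takeWhileᵇ q γ ↭ γ
  rotation-↭ q γ = ↭-trans (++-comm (dropWhileᵇ q γ) (takeWhileᵇ q γ))
    (P.subst (_↭ γ) (P.sym (takeWhile++dropWhile q γ)) ↭-refl)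

module FiniteSums {c ℓ} (F : Field c ℓ) where
  open Field F public
  open RingSolver (fromCommutativeRing commutativeRing (λ _ → nothing)) public using (solve; _⊜_)
  open import Relation.Binary.Reasoning.Setoid setoid public

  -0≈0 : - 0# ≈ 0#
  -0≈0 = trans (sym (+-identityˡ (- 0#))) (-‿inverseʳ 0#)

  sumL : ∀ {a} {A : Set a} → List A → (A → Carrier) → Carrier
  sumL xs f = foldr (λ x acc → f x + acc) 0# xs

  module _ {a} {A : Set a} where

    sumL-congᵐ : ∀ (xs : List A) {f g : A → Carrier} → (∀ {x} → x ∈ xs → f x ≈ g x) → sumL xs f ≈ sumL xs g
    sumL-congᵐ [] h = refl
    sumL-congᵐ (x ∷ xs) h = +-cong (h (here P.refl)) (sumL-congᵐ xs (h ∘ there))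

    sumL-cong : ∀ (xs : List A) {f g : A → Carrier} → (∀ x → f x ≈ g x) → sumL xs f ≈ sumL xs g
    sumL-cong xs h = sumL-congᵐ xs (λ {x} _ → h x)

    sumL-0ᵐ : ∀ (xs : List A) {f : A → Carrier} → (∀ {x} → x ∈ xs → f x ≈ 0#) → sumL xs f ≈ 0#
    sumL-0ᵐ [] h = refl
    sumL-0ᵐ (x ∷ xs) h = trans (+-cong (h (here P.refl)) (sumL-0ᵐ xs (h ∘ there))) (+-identityˡ 0#)

    sumL-0 : ∀ (xs : List A) {f : A → Carrier} → (∀ x → f x ≈ 0#) → sumL xs f ≈ 0#
    sumL-0 xs h = sumL-0ᵐ xs (λ {x} _ → h x)

    sumL-++ : ∀ (xs ys : List A) (f : A → Carrier) → sumL (xs ++ ys) f ≈ sumL xs f + sumL ys f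
    sumL-++ [] ys f = sym (+-identityˡ _)
    sumL-++ (x ∷ xs) ys f = trans (+-cong refl (sumL-++ xs ys f)) (sym (+-assoc _ _ _))

    sumL-+ : ∀ (xs : List A) (f g : A → Carrier) → sumL xs (λ x → f x + g x) ≈ sumL xs f + sumL xs g
    sumL-+ [] f g = sym (+-identityˡ 0#)
    sumL-+ (x ∷ xs) f g = trans (+-cong refl (sumL-+ xs f g))
      (solve 4 (λ a b d e → ((a ⊕ b) ⊕ (d ⊕ e)) ⊜ ((a ⊕ d) ⊕ (b ⊕ e))) refl (f x) (g x) (sumL xs f) (sumL xs g))

    sumL-*ˡ : ∀ (xs : List A) (k : Carrier) (f : A → Carrier) → sumL xs (λ x → k * f x) ≈ k * sumL xs f
    sumL-*ˡ [] k f = sym (zeroʳ k)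
    sumL-*ˡ (x ∷ xs) k f = trans (+-cong refl (sumL-*ˡ xs k f)) (sym (distribˡ k _ _))

    sumL-*ʳ : ∀ (xs : List A) (k : Carrier) (f : A → Carrier) → sumL xs (λ x → f x * k) ≈ sumL xs f * k
    sumL-*ʳ xs k f = trans (sumL-cong xs (λ x → *-comm (f x) k)) (trans (sumL-*ˡ xs k f) (*-comm k _))

    sumL-neg : ∀ (xs : List A) (f : A → Carrier) → sumL xs (λ x → - f x) ≈ - sumL xs f
    sumL-neg [] f = sym -0≈0
    sumL-neg (x ∷ xs) f = trans (+-cong refl (sumL-neg xs f))
      (solve 2 (λ a b → ((⊝ a) ⊕ (⊝ b)) ⊜ (⊝ (a ⊕ b))) refl (f x) (sumL xs f))

    sumL-↭ : ∀ {xs ys : List A} (f : A → Carrier) → xs ↭ ys → sumL xs f ≈ sumL ys f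
    sumL-↭ f Perm.refl = refl
    sumL-↭ f (Perm.prep x p) = +-cong refl (sumL-↭ f p)
    sumL-↭ f (Perm.swap x y p) = trans (+-cong refl (+-cong refl (sumL-↭ f p)))
      (solve 3 (λ a b d → (a ⊕ (b ⊕ d)) ⊜ (b ⊕ (a ⊕ d))) refl (f x) (f y) _)
    sumL-↭ f (Perm.trans p q) = trans (sumL-↭ f p) (sumL-↭ f q)

    sumL-reindex : ∀ (L M : List A) (t g : A → Carrier) → Unique L → Unique M →
       (∀ {w} → w ∈ L → (w ∈ M × t w ≈ g w) ⊎ (w ∉ M × t w ≈ 0#)) →
       (∀ {w} → w ∈ M → w ∉ L → g w ≈ 0#) → sumL L t ≈ sumL M g
    sumL-reindex [] M t g uL uM h₁ h₂ = sym (sumL-0ᵐ M (λ m → h₂ m (λ ())))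
    sumL-reindex (l ∷ L) M t g (hl ∷ uL) uM h₁ h₂ with h₁ (here P.refl)
    ... | inj₂ (l∉M , tl≈0) = trans (+-cong tl≈0 (sumL-reindex L M t g uL uM (h₁ ∘ there) h₂')) (+-identityˡ _)
      where h₂' : ∀ {w} → w ∈ M → w ∉ L → g w ≈ 0#
            h₂' m w∉ = h₂ m λ { (here P.refl) → l∉M m ; (there m') → w∉ m' }
    ... | inj₁ (l∈M , tl≈gl) with ∈-∃++ l∈M
    ...   | xs , ys , P.refl with Unique-delete xs uM
    ...     | uM' , l∉M' =
      trans (+-cong tl≈gl (sumL-reindex L (xs ++ ys) t g uL uM' h₁' h₂')) (sym (sumL-↭ g (shift l xs ys)))
      where
        h₁' : ∀ {w} → w ∈ L → (w ∈ xs ++ ys × t w ≈ g w) ⊎ (w ∉ xs ++ ys × t w ≈ 0#)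
        h₁' m with h₁ (there m)
        ... | inj₁ (wM , e) = inj₁ (∈-delete⁻ xs wM (λ { P.refl → All¬⇒¬Any hl m }) , e)
        ... | inj₂ (w∉M , e) = inj₂ ((λ m' → w∉M (∈-delete⁺ xs m')) , e)
        h₂' : ∀ {w} → w ∈ xs ++ ys → w ∉ L → g w ≈ 0#
        h₂' m w∉ = h₂ (∈-delete⁺ xs m) λ { (here P.refl) → l∉M' m ; (there m') → w∉ m' }

  module _ {a b} {A : Set a} {B : Set b} where

    sumL-map : ∀ (xs : List A) (h : A → B) (f : B → Carrier) → sumL (map h xs) f ≡ sumL xs (f ∘ h)
    sumL-map [] h f = P.refl
    sumL-map (x ∷ xs) h f = P.cong (f (h x) +_) (sumL-map xs h f)

    sumL-concatMap : ∀ (xs : List A) (h : A → List B) (f : B → Carrier) →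
      sumL (concatMap h xs) f ≈ sumL xs (λ x → sumL (h x) f)
    sumL-concatMap [] h f = refl
    sumL-concatMap (x ∷ xs) h f = trans (sumL-++ (h x) (concatMap h xs) f) (+-cong refl (sumL-concatMap xs h f))

    sumL-swap : ∀ (xs : List A) (ys : List B) (f : A → B → Carrier) →
      sumL xs (λ x → sumL ys (f x)) ≈ sumL ys (λ y → sumL xs (λ x → f x y))
    sumL-swap [] ys f = sym (sumL-0 ys (λ _ → refl))
    sumL-swap (x ∷ xs) ys f = trans (+-cong refl (sumL-swap xs ys f))
      (sym (sumL-+ ys (f x) (λ y → sumL xs (λ x → f x y))))

-- Shuffles and deconcatenations of words.  `sh as bs` lists the shuffles of as
-- and bs (with multiplicity), `splits w` the factorisations w = s ++ t.

module _ {a} {A : Set a} where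

  sh : List A → List A → List (List A)
  sh [] bs = bs ∷ []
  sh (x ∷ as) [] = (x ∷ as) ∷ []
  sh (x ∷ as) (y ∷ bs) = map (x ∷_) (sh as (y ∷ bs)) ++ map (y ∷_) (sh (x ∷ as) bs)

  sh-[] : ∀ as → sh as [] ≡ as ∷ []
  sh-[] [] = P.refl
  sh-[] (x ∷ as) = P.refl

  splits : List A → List (List A × List A)
  splits [] = ([] , []) ∷ []
  splits (x ∷ w) = ([] , x ∷ w) ∷ map (λ st → (x ∷ proj₁ st , proj₂ st)) (splits w)

  splits-sound : ∀ (w : List A) {st} → st ∈ splits w → proj₁ st ++ proj₂ st ≡ w
  splits-sound [] (here P.refl) = P.refl
  splits-sound (x ∷ w) (here P.refl) = P.refl
  splits-sound (x ∷ w) (there m) with ∈-map⁻ _ m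
  ... | st' , m' , P.refl = P.cong (x ∷_) (splits-sound w m')

  sh-length : ∀ (as bs : List A) {w} → w ∈ sh as bs → length w ≡ length as ℕ.+ length bs
  sh-length [] bs (here P.refl) = P.refl
  sh-length (x ∷ as) [] (here P.refl) = P.cong suc (P.sym (NP.+-identityʳ _))
  sh-length (x ∷ as) (y ∷ bs) m with ∈-++⁻ (map (x ∷_) (sh as (y ∷ bs))) m
  ... | inj₁ m₁ with ∈-map⁻ _ m₁
  ...   | w' , m' , P.refl = P.cong suc (sh-length as (y ∷ bs) m')
  sh-length (x ∷ as) (y ∷ bs) m | inj₂ m₂ with ∈-map⁻ _ m₂
  ...   | w' , m' , P.refl = P.cong suc (P.trans (sh-length (x ∷ as) bs m') (P.sym (NP.+-suc _ _)))

module ShuffleSums {c ℓ} (F : Field c ℓ) {a} {A : Set a} where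
  open FiniteSums F

  Sp : List A → (List A → List A → Carrier) → Carrier
  Sp w K = sumL (splits w) (λ st → K (proj₁ st) (proj₂ st))

  Sh : List A → List A → (List A → Carrier) → Carrier
  Sh as bs f = sumL (sh as bs) f

  Sp-cong : ∀ w {K K'} → (∀ s t → K s t ≈ K' s t) → Sp w K ≈ Sp w K'
  Sp-cong w h = sumL-cong (splits w) (λ st → h (proj₁ st) (proj₂ st))

  Sh-cong : ∀ as bs {f g} → (∀ w → f w ≈ g w) → Sh as bs f ≈ Sh as bs g
  Sh-cong as bs h = sumL-cong (sh as bs) h

  Sp-[] : ∀ K → Sp [] K ≈ K [] []
  Sp-[] K = +-identityʳ _

  Sp-∷ : ∀ x w K → Sp (x ∷ w) K ≈ K [] (x ∷ w) + Sp w (λ s t → K (x ∷ s) t)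
  Sp-∷ x w K = +-cong refl (reflexive (sumL-map (splits w) (λ st → (x ∷ proj₁ st , proj₂ st)) (λ st → K (proj₁ st) (proj₂ st))))

  Sp-+ : ∀ w K L → Sp w (λ s t → K s t + L s t) ≈ Sp w K + Sp w L
  Sp-+ w K L = sumL-+ (splits w) _ _

  Sp-0 : ∀ w K → (∀ s t → s ++ t ≡ w → K s t ≈ 0#) → Sp w K ≈ 0#
  Sp-0 w K h = sumL-0ᵐ (splits w) (λ {st} m → h (proj₁ st) (proj₂ st) (splits-sound w m))

  Sp-at : ∀ (u v : List A) K → (∀ s t → s ++ t ≡ u ++ v → s ≢ u → K s t ≈ 0#) → Sp (u ++ v) K ≈ K u v
  Sp-at [] [] K h = Sp-[] K
  Sp-at [] (y ∷ v) K h = trans (Sp-∷ y v K)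
    (trans (+-cong refl (Sp-0 v _ (λ s t e → h (y ∷ s) t (P.cong (y ∷_) e) (λ ())))) (+-identityʳ _))
  Sp-at (x ∷ u) v K h = trans (Sp-∷ x (u ++ v) K)
    (trans (+-cong (h [] (x ∷ u ++ v) P.refl (λ ()))
                   (Sp-at u v _ (λ s t e ne → h (x ∷ s) t (P.cong (x ∷_) e) (ne ∘ LP.∷-injectiveʳ))))
           (+-identityˡ _))

  Sh-[]ˡ : ∀ bs f → Sh [] bs f ≈ f bs
  Sh-[]ˡ bs f = +-identityʳ _

  Sh-[]ʳ : ∀ as f → Sh as [] f ≈ f as
  Sh-[]ʳ as f rewrite sh-[] as = +-identityʳ _

  Sh-∷∷ : ∀ x as y bs f → Sh (x ∷ as) (y ∷ bs) f ≈ Sh as (y ∷ bs) (f ∘ (x ∷_)) + Sh (x ∷ as) bs (f ∘ (y ∷_))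
  Sh-∷∷ x as y bs f = trans (sumL-++ (map (x ∷_) (sh as (y ∷ bs))) _ f)
    (+-cong (reflexive (sumL-map (sh as (y ∷ bs)) (x ∷_) f)) (reflexive (sumL-map (sh (x ∷ as) bs) (y ∷_) f)))

  Sh-+ : ∀ as bs f g → Sh as bs (λ u → f u + g u) ≈ Sh as bs f + Sh as bs g
  Sh-+ as bs f g = sumL-+ (sh as bs) f g

  shuffle-split : ∀ as bs Fn →
    Sh as bs (λ w → Sp w Fn) ≈ Sp as (λ a₁ a₂ → Sp bs (λ b₁ b₂ → Sh a₁ b₁ (λ u → Sh a₂ b₂ (Fn u))))
  shuffle-split [] bs Fn = begin
    Sh [] bs (λ w → Sp w Fn) ≈⟨ Sh-[]ˡ bs (λ w → Sp w Fn) ⟩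
    Sp bs Fn ≈⟨ Sp-cong bs (λ s t → sym (trans (Sh-[]ˡ s (λ u → Sh [] t (Fn u))) (Sh-[]ˡ t (Fn s)))) ⟩
    Sp bs (λ b₁ b₂ → Sh [] b₁ (λ u → Sh [] b₂ (Fn u)))
      ≈⟨ sym (Sp-[] (λ a₁ a₂ → Sp bs (λ b₁ b₂ → Sh a₁ b₁ (λ u → Sh a₂ b₂ (Fn u))))) ⟩
    Sp [] (λ a₁ a₂ → Sp bs (λ b₁ b₂ → Sh a₁ b₁ (λ u → Sh a₂ b₂ (Fn u)))) ∎
  shuffle-split (x ∷ as) [] Fn = begin
    Sh (x ∷ as) [] (λ w → Sp w Fn) ≈⟨ Sh-[]ʳ (x ∷ as) (λ w → Sp w Fn) ⟩
    Sp (x ∷ as) Fn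
      ≈⟨ Sp-cong (x ∷ as) (λ s t → sym (trans (Sp-[] (λ b₁ b₂ → Sh s b₁ (λ u → Sh t b₂ (Fn u))))
                                              (trans (Sh-[]ʳ s (λ u → Sh t [] (Fn u))) (Sh-[]ʳ t (Fn s))))) ⟩
    Sp (x ∷ as) (λ a₁ a₂ → Sp [] (λ b₁ b₂ → Sh a₁ b₁ (λ u → Sh a₂ b₂ (Fn u)))) ∎
  shuffle-split (x ∷ as) (y ∷ bs) Fn = begin
    Sh (x ∷ as) (y ∷ bs) (λ w → Sp w Fn)
      ≈⟨ Sh-∷∷ x as y bs _ ⟩
    Sh as (y ∷ bs) (λ w → Sp (x ∷ w) Fn) + Sh (x ∷ as) bs (λ w → Sp (y ∷ w) Fn)
      ≈⟨ +-cong (trans (Sh-cong as (y ∷ bs) (λ w → Sp-∷ x w Fn)) (Sh-+ as (y ∷ bs) _ _))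
                (trans (Sh-cong (x ∷ as) bs (λ w → Sp-∷ y w Fn)) (Sh-+ (x ∷ as) bs _ _)) ⟩
    (T₁ + Sh as (y ∷ bs) (λ w → Sp w Fx)) + (T₂ + Sh (x ∷ as) bs (λ w → Sp w Fy))
      ≈⟨ +-cong (+-cong refl (trans (shuffle-split as (y ∷ bs) Fx) R₁))
                (+-cong refl (trans (shuffle-split (x ∷ as) bs Fy) R₂)) ⟩
    (T₁ + (U + V)) + (T₂ + (W + X))
      ≈⟨ solve 6 (λ t₁ t₂ u v w x' → ((t₁ ⊕ (u ⊕ v)) ⊕ (t₂ ⊕ (w ⊕ x'))) ⊜ (((t₁ ⊕ t₂) ⊕ w) ⊕ (u ⊕ (v ⊕ x'))))
                 refl T₁ T₂ U V W X ⟩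
    ((T₁ + T₂) + W) + (U + (V + X))
      ≈⟨ sym (+-cong R₃ R₄) ⟩
    G [] (x ∷ as) + Sp as (λ s t → G (x ∷ s) t)
      ≈⟨ sym (Sp-∷ x as G) ⟩
    Sp (x ∷ as) G ∎
    where
      Fx = λ u v → Fn (x ∷ u) v
      Fy = λ u v → Fn (y ∷ u) v
      T₁ = Sh as (y ∷ bs) (λ w → Fn [] (x ∷ w))
      T₂ = Sh (x ∷ as) bs (λ w → Fn [] (y ∷ w))
      G = λ a₁ a₂ → Sp (y ∷ bs) (λ b₁ b₂ → Sh a₁ b₁ (λ u → Sh a₂ b₂ (Fn u)))
      U = Sp as (λ s t → Sh t (y ∷ bs) (Fn (x ∷ s)))
      V = Sp as (λ s t → Sp bs (λ s' t' → Sh s (y ∷ s') (λ u → Sh t t' (Fn (x ∷ u)))))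
      W = Sp bs (λ s' t' → Sh (x ∷ as) t' (Fn (y ∷ s')))
      X = Sp as (λ s t → Sp bs (λ s' t' → Sh (x ∷ s) s' (λ u → Sh t t' (Fn (y ∷ u)))))
      R₁ : Sp as (λ a₁ a₂ → Sp (y ∷ bs) (λ b₁ b₂ → Sh a₁ b₁ (λ u → Sh a₂ b₂ (Fx u)))) ≈ U + V
      R₁ = trans (Sp-cong as (λ s t → trans (Sp-∷ y bs _) (+-cong (Sh-[]ʳ s (λ u → Sh t (y ∷ bs) (Fx u))) refl)))
                 (Sp-+ as _ _)
      R₂ : Sp (x ∷ as) (λ a₁ a₂ → Sp bs (λ b₁ b₂ → Sh a₁ b₁ (λ u → Sh a₂ b₂ (Fy u)))) ≈ W + X
      R₂ = trans (Sp-∷ x as _) (+-cong (Sp-cong bs (λ s' t' → Sh-[]ˡ s' (λ u → Sh (x ∷ as) t' (Fy u)))) refl)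
      R₃ : G [] (x ∷ as) ≈ (T₁ + T₂) + W
      R₃ = trans (Sp-∷ y bs _)
             (+-cong (trans (Sh-[]ˡ [] (λ u → Sh (x ∷ as) (y ∷ bs) (Fn u))) (Sh-∷∷ x as y bs (Fn [])))
                     (Sp-cong bs (λ s t → Sh-[]ˡ (y ∷ s) (λ u → Sh (x ∷ as) t (Fn u)))))
      R₄ : Sp as (λ s t → G (x ∷ s) t) ≈ U + (V + X)
      R₄ = trans (Sp-cong as (λ s t → trans (Sp-∷ y bs _)
                   (+-cong (Sh-[]ʳ (x ∷ s) (λ u → Sh t (y ∷ bs) (Fn u)))
                           (trans (Sp-cong bs (λ s' t' → Sh-∷∷ x s y s' (λ u → Sh t t' (Fn u)))) (Sp-+ bs _ _)))))
                 (trans (Sp-+ as _ _) (+-cong refl (Sp-+ as _ _)))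

-- The
-- compatibility `shuffle-split` makes the commutator of primitives primitive.

module Primitives {c ℓ} (F : Field c ℓ) {a} {A : Set a} where
  open FiniteSums F
  open ShuffleSums F {A = A}

  mul : (List A → Carrier) → (List A → Carrier) → List A → Carrier
  mul x y w = Sp w (λ u v → x u * y v)

  Prim : (List A → Carrier) → Set _
  Prim x = ∀ a as b bs → Sh (a ∷ as) (b ∷ bs) x ≈ 0#

  Prim-resp : ∀ {x y : List A → Carrier} → (∀ w → x w ≈ y w) → Prim x → Prim y
  Prim-resp {x} {y} h px a as b bs = trans (sym (Sh-cong (a ∷ as) (b ∷ bs) h)) (px a as b bs)

  Prim-0 : Prim (λ _ → 0#)
  Prim-0 a as b bs = sumL-0 (sh (a ∷ as) (b ∷ bs)) (λ _ → refl)

  Sp-first : ∀ w K → (∀ z s t → K (z ∷ s) t ≈ 0#) → Sp w K ≈ K [] w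
  Sp-first [] K h = Sp-[] K
  Sp-first (x ∷ w) K h = trans (Sp-∷ x w K) (trans (+-cong refl (sumL-0 (splits w) (λ st → h x _ _))) (+-identityʳ _))

  Sp-last : ∀ w K → (∀ s z t → K s (z ∷ t) ≈ 0#) → Sp w K ≈ K w []
  Sp-last [] K h = Sp-[] K
  Sp-last (x ∷ w) K h =
    trans (Sp-∷ x w K) (trans (+-cong (h [] x w) (Sp-last w _ (λ s z t → h (x ∷ s) z t))) (+-identityˡ _))

  Sp-ends : ∀ x w K → (∀ z s z' t → K (z ∷ s) (z' ∷ t) ≈ 0#) → Sp (x ∷ w) K ≈ K [] (x ∷ w) + K (x ∷ w) []
  Sp-ends x w K h = trans (Sp-∷ x w K) (+-cong refl (Sp-last w _ (λ s z t → h x s z t)))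

  Sh-mul : ∀ as bs x y → Sh as bs (mul x y) ≈ Sp as (λ a₁ a₂ → Sp bs (λ b₁ b₂ → Sh a₁ b₁ x * Sh a₂ b₂ y))
  Sh-mul as bs x y = trans (shuffle-split as bs _)
    (Sp-cong as (λ a₁ a₂ → Sp-cong bs (λ b₁ b₂ →
      trans (Sh-cong a₁ b₁ (λ u → sumL-*ˡ (sh a₂ b₂) (x u) y)) (sumL-*ʳ (sh a₁ b₁) (Sh a₂ b₂ y) x))))

  double-split-ends : ∀ (X Y : List A → List A → Carrier) →
    (∀ a as b bs → X (a ∷ as) (b ∷ bs) ≈ 0#) → (∀ a as b bs → Y (a ∷ as) (b ∷ bs) ≈ 0#) →
    ∀ a as b bs → Sp (a ∷ as) (λ a₁ a₂ → Sp (b ∷ bs) (λ b₁ b₂ → X a₁ b₁ * Y a₂ b₂))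
                    ≈ X [] (b ∷ bs) * Y (a ∷ as) [] + X (a ∷ as) [] * Y [] (b ∷ bs)
  double-split-ends X Y hX hY a as b bs = trans (Sp-ends a as _ inner0) (+-cong left right)
    where
      inner0 : ∀ z s z' t → Sp (b ∷ bs) (λ b₁ b₂ → X (z ∷ s) b₁ * Y (z' ∷ t) b₂) ≈ 0#
      inner0 z s z' t = trans (Sp-first (b ∷ bs) _ (λ z'' s' t' → trans (*-cong (hX z s z'' s') refl) (zeroˡ _)))
                              (trans (*-cong refl (hY z' t b bs)) (zeroʳ _))
      left : Sp (b ∷ bs) (λ b₁ b₂ → X [] b₁ * Y (a ∷ as) b₂) ≈ X [] (b ∷ bs) * Y (a ∷ as) []
      left = Sp-last (b ∷ bs) _ (λ s z t → trans (*-cong refl (hY a as z t)) (zeroʳ _))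
      right : Sp (b ∷ bs) (λ b₁ b₂ → X (a ∷ as) b₁ * Y [] b₂) ≈ X (a ∷ as) [] * Y [] (b ∷ bs)
      right = Sp-first (b ∷ bs) _ (λ z s t → trans (*-cong (hX a as z s) refl) (zeroˡ _))

  prim-bracket : ∀ x y → Prim x → Prim y → Prim (λ w → mul x y w - mul y x w)
  prim-bracket x y px py a as b bs = begin
    Sh A' B (λ w → mul x y w - mul y x w)
      ≈⟨ trans (Sh-+ A' B _ _) (+-cong refl (sumL-neg (sh A' B) _)) ⟩
    Sh A' B (mul x y) - Sh A' B (mul y x)
      ≈⟨ +-cong (trans (Sh-mul A' B x y) (double-split-ends X Y px py a as b bs))
                (-‿cong (trans (Sh-mul A' B y x) (double-split-ends Y X py px a as b bs))) ⟩
    (X [] B * Y A' [] + X A' [] * Y [] B) - (Y [] B * X A' [] + Y A' [] * X [] B)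
      ≈⟨ solve 4 (λ p q r s → (((p ⊗ q) ⊕ (r ⊗ s)) ⊕ (⊝ ((s ⊗ r) ⊕ (q ⊗ p))))
                              ⊜ (((p ⊗ q) ⊕ (r ⊗ s)) ⊕ (⊝ ((p ⊗ q) ⊕ (r ⊗ s)))))
                 refl (X [] B) (Y A' []) (X A' []) (Y [] B) ⟩
    _ ≈⟨ -‿inverseʳ _ ⟩
    0# ∎
    where
      X = λ s t → Sh s t x
      Y = λ s t → Sh s t y
      A' = a ∷ as
      B = b ∷ bs

module Evaluation {c ℓ} (F : Field c ℓ) (n : ℕ) where
  open FiniteSums F
  open ShuffleSums F {A = Fin n}
  open Primitives F {A = Fin n}

  Word : Set
  Word = List (Fin n)

  ev : Poly F {n} → Word → Carrier
  ev P = ⟦_⟧ F P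

  δ : Word → Word → Carrier
  δ u w = if u ≟w w then 1# else 0#

  ≟w-yes : ∀ {u w : Word} → u ≡ w → (u ≟w w) ≡ true
  ≟w-yes {u} {w} = dec-true (LP.≡-dec Fin._≟_ u w)

  ≟w-no : ∀ {u w : Word} → u ≢ w → (u ≟w w) ≡ false
  ≟w-no {u} {w} = dec-false (LP.≡-dec Fin._≟_ u w)

  δ-refl : ∀ u → δ u u ≈ 1#
  δ-refl u rewrite ≟w-yes {u} {u} P.refl = refl

  δ-ne : ∀ u w → u ≢ w → δ u w ≈ 0#
  δ-ne u w ne rewrite ≟w-no {u} {w} ne = refl

  δ-∷ : ∀ x r s → δ (x ∷ r) (x ∷ s) ≈ δ r s
  δ-∷ x r s = cases (LP.≡-dec Fin._≟_ r s)
    where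
      cases : Dec (r ≡ s) → δ (x ∷ r) (x ∷ s) ≈ δ r s
      cases (yes P.refl) = trans (δ-refl (x ∷ r)) (sym (δ-refl r))
      cases (no ne) = trans (δ-ne (x ∷ r) (x ∷ s) (ne ∘ LP.∷-injectiveʳ)) (sym (δ-ne r s ne))

  if≈*δ : ∀ (b : Bool) (k : Carrier) → (if b then k else 0#) ≈ k * (if b then 1# else 0#)
  if≈*δ true k = sym (*-identityʳ k)
  if≈*δ false k = sym (zeroʳ k)

  ev-δ : ∀ P w → ev P w ≈ sumL P (λ cu → proj₁ cu * δ (proj₂ cu) w)
  ev-δ P w = sumL-cong P (λ cu → if≈*δ (proj₂ cu ≟w w) (proj₁ cu))

  split-δ : ∀ u v w → Sp w (λ s t → δ u s * δ v t) ≈ δ (u ++ v) w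
  split-δ [] v w = trans (Sp-first w _ (λ z s t → trans (*-cong (δ-ne [] (z ∷ s) (λ ())) refl) (zeroˡ _)))
                         (trans (*-cong (δ-refl []) refl) (*-identityˡ _))
  split-δ (x ∷ u) v [] = trans (Sp-[] (λ s t → δ (x ∷ u) s * δ v t)) (trans (*-cong (δ-ne (x ∷ u) [] (λ ())) refl)
                                         (trans (zeroˡ _) (sym (δ-ne (x ∷ u ++ v) [] (λ ())))))
  split-δ (x ∷ u) v (z ∷ w) =
    trans (Sp-∷ z w (λ s t → δ (x ∷ u) s * δ v t)) (trans (+-cong (trans (*-cong (δ-ne (x ∷ u) [] (λ ())) refl) (zeroˡ _)) tail) (+-identityˡ _))
    where
      tail : Sp w (λ s t → δ (x ∷ u) (z ∷ s) * δ v t) ≈ δ (x ∷ u ++ v) (z ∷ w)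
      tail = heads (x Fin.≟ z)
        where
          heads : Dec (x ≡ z) → Sp w (λ s t → δ (x ∷ u) (z ∷ s) * δ v t) ≈ δ (x ∷ u ++ v) (z ∷ w)
          heads (yes P.refl) = trans (Sp-cong w (λ s t → *-cong (δ-∷ x u s) refl))
                                     (trans (split-δ u v w) (sym (δ-∷ x (u ++ v) w)))
          heads (no ne) =
            trans (sumL-0 (splits w) (λ st → trans (*-cong (δ-ne (x ∷ u) (z ∷ proj₁ st) (ne ∘ LP.∷-injectiveˡ)) refl)
                                                   (zeroˡ _)))
                  (sym (δ-ne (x ∷ u ++ v) (z ∷ w) (ne ∘ LP.∷-injectiveˡ)))

  prodform : Poly F {n} → Poly F {n} → Word → Carrier
  prodform P Q w = sumL P (λ cu → sumL Q (λ dv → (proj₁ cu * proj₁ dv) * δ (proj₂ cu ++ proj₂ dv) w))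

  mul-form : ∀ P Q w → mul (ev P) (ev Q) w ≈ prodform P Q w
  mul-form P Q w = begin
    Sp w (λ s t → ev P s * ev Q t)
      ≈⟨ Sp-cong w (λ s t → *-cong (ev-δ P s) (ev-δ Q t)) ⟩
    Sp w (λ s t → sumL P (λ cu → proj₁ cu * δ (proj₂ cu) s) * sumL Q (λ dv → proj₁ dv * δ (proj₂ dv) t))
      ≈⟨ Sp-cong w (λ s t → trans (sym (sumL-*ʳ P _ _)) (sumL-cong P (λ cu → sym (sumL-*ˡ Q _ _)))) ⟩
    sumL (splits w) (λ st → sumL P (λ cu → sumL Q (λ dv → term cu dv (proj₁ st) (proj₂ st))))
      ≈⟨ trans (sumL-swap (splits w) P _) (sumL-cong P (λ cu → sumL-swap (splits w) Q _)) ⟩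
    sumL P (λ cu → sumL Q (λ dv → Sp w (term cu dv)))
      ≈⟨ sumL-cong P (λ cu → sumL-cong Q (λ dv → trans
           (Sp-cong w (λ s t → solve 4 (λ a b d e → ((a ⊗ b) ⊗ (d ⊗ e)) ⊜ ((a ⊗ d) ⊗ (b ⊗ e)))
                                        refl (proj₁ cu) (δ (proj₂ cu) s) (proj₁ dv) (δ (proj₂ dv) t)))
           (trans (sumL-*ˡ (splits w) (proj₁ cu * proj₁ dv) _) (*-cong refl (split-δ (proj₂ cu) (proj₂ dv) w))))) ⟩
    prodform P Q w ∎
    where
      term : Carrier × Word → Carrier × Word → Word → Word → Carrier
      term cu dv s t = (proj₁ cu * δ (proj₂ cu) s) * (proj₁ dv * δ (proj₂ dv) t)

  ev-bracket : ∀ P Q w → ev (bracket F P Q) w ≈ mul (ev P) (ev Q) w - mul (ev Q) (ev P) w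
  ev-bracket P Q w = begin
    ev (bracket F P Q) w
      ≈⟨ sumL-++ (concatMap f₁ P) (concatMap f₂ P) _ ⟩
    ev (concatMap f₁ P) w + ev (concatMap f₂ P) w
      ≈⟨ +-cong (sumL-concatMap P f₁ _) (sumL-concatMap P f₂ _) ⟩
    sumL P (λ cu → sumL (f₁ cu) h) + sumL P (λ cu → sumL (f₂ cu) h)
      ≈⟨ +-cong (sumL-cong P (λ cu → reflexive (sumL-map Q _ h))) (sumL-cong P (λ cu → reflexive (sumL-map Q _ h))) ⟩
    sumL P (λ cu → sumL Q (λ dv → h (proj₁ cu * proj₁ dv , proj₂ cu ++ proj₂ dv)))
      + sumL P (λ cu → sumL Q (λ dv → h (- (proj₁ cu * proj₁ dv) , proj₂ dv ++ proj₂ cu)))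
      ≈⟨ +-cong (sumL-cong P (λ cu → sumL-cong Q (λ dv → if≈*δ _ _)))
                (trans (sumL-cong P (λ cu → sumL-cong Q (λ dv → trans (if≈*δ _ _)
                         (trans (sym (-‿distribˡ-* _ _)) (-‿cong (*-cong (*-comm _ _) refl))))))
                (trans (sumL-cong P (λ cu → sumL-neg Q _)) (trans (sumL-neg P _) (-‿cong (sumL-swap P Q _))))) ⟩
    prodform P Q w - prodform Q P w
      ≈⟨ sym (+-cong (mul-form P Q w) (-‿cong (mul-form Q P w))) ⟩
    mul (ev P) (ev Q) w - mul (ev Q) (ev P) w ∎
    where
      open RingProperties ring using (-‿distribˡ-*)
      f₁ = λ (cu : Carrier × Word) → map (λ (dv : Carrier × Word) → (proj₁ cu * proj₁ dv , proj₂ cu ++ proj₂ dv)) Q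
      f₂ = λ (cu : Carrier × Word) → map (λ (dv : Carrier × Word) → (- (proj₁ cu * proj₁ dv) , proj₂ dv ++ proj₂ cu)) Q
      h = λ (cu : Carrier × Word) → if proj₂ cu ≟w w then proj₁ cu else 0#

  ev-letter-self : ∀ (a : Fin n) → ev ((1# , a ∷ []) ∷ []) (a ∷ []) ≈ 1#
  ev-letter-self a rewrite ≟w-yes {a ∷ []} {a ∷ []} P.refl = +-identityʳ 1#

  ev-letter-other : ∀ (a : Fin n) w → w ≢ a ∷ [] → ev ((1# , a ∷ []) ∷ []) w ≈ 0#
  ev-letter-other a w ne rewrite ≟w-no {a ∷ []} {w} (ne ∘ P.sym) = +-identityʳ 0#

module PGammaPrimitive {c ℓ} (F : Field c ℓ) (n : ℕ) where
  open FiniteSums F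
  open ShuffleSums F {A = Fin n}
  open Primitives F {A = Fin n}
  open Evaluation F n

  pv : ℕ → Word → Word → Word → Carrier
  pv k ℓ' γ = ev (pFuel F k ℓ' γ)

  mul-supp : ∀ (x y : Word → Carrier) (S T γ w : Word) → S ++ T ↭ γ → ¬ (w ↭ γ) →
    (∀ u → ¬ (u ↭ S) → x u ≈ 0#) → (∀ v → ¬ (v ↭ T) → y v ≈ 0#) → mul x y w ≈ 0#
  mul-supp x y S T γ w p w≁γ hx hy = Sp-0 w _ term0
    where
      term0 : ∀ s t → s ++ t ≡ w → x s * y t ≈ 0#
      term0 s t e with _↭?_ Fin._≟_ s S
      ... | no s≁S = trans (*-cong (hx s s≁S) refl) (zeroˡ _)
      ... | yes ps with _↭?_ Fin._≟_ t T
      ...   | no t≁T = trans (*-cong refl (hy t t≁T)) (zeroʳ _)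
      ...   | yes pt = ⊥-elim (w≁γ (P.subst (_↭ γ) e (↭-trans (++⁺ ps pt) p)))

  bracket-supp : ∀ P Q (S T γ w : Word) → S ++ T ↭ γ → ¬ (w ↭ γ) →
    (∀ u → ¬ (u ↭ S) → ev P u ≈ 0#) → (∀ v → ¬ (v ↭ T) → ev Q v ≈ 0#) → ev (bracket F P Q) w ≈ 0#
  bracket-supp P Q S T γ w p w≁γ hx hy =
    trans (ev-bracket P Q w)
      (trans (+-cong (mul-supp (ev P) (ev Q) S T γ w p w≁γ hx hy)
                     (-‿cong (mul-supp (ev Q) (ev P) T S γ w (↭-trans (++-comm T S) p) w≁γ hy hx)))
        (trans (+-identityˡ _) -0≈0))

  p-supp : ∀ k (ℓ' γ : Word) w → ¬ (w ↭ γ) → pv k ℓ' γ w ≈ 0#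
  p-supp k ℓ' [] w w≁γ = refl
  p-supp k ℓ' (a ∷ []) w w≁γ = ev-letter-other a w (λ { P.refl → w≁γ ↭-refl })
  p-supp zero ℓ' (a ∷ b ∷ r) w w≁γ = refl
  p-supp (suc k) ℓ' (a ∷ b ∷ r) w w≁γ with restrict ℓ' (a ∷ b ∷ r)
  ... | [] = refl
  ... | _ ∷ [] = refl
  ... | i₁ ∷ i₂ ∷ _ =
    bracket-supp (pFuel F k (restrict ℓ' S) S) (pFuel F k (restrict ℓ' T) T) S T (a ∷ b ∷ r) w
      (P.subst (_↭ (a ∷ b ∷ r)) (P.sym (takeWhile++dropWhile (λ i → not (i == i₂)) γ'))
               (rotation-↭ (λ i → not (i == i₁)) (a ∷ b ∷ r)))
      w≁γ (λ u → p-supp k _ S u) (λ v → p-supp k _ T v)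
    where
      γ' = rotateTo i₁ (a ∷ b ∷ r)
      S = takeWhileᵇ (λ i → not (i == i₂)) γ'
      T = dropWhileᵇ (λ i → not (i == i₂)) γ'

  -- a single letter has no shuffle sums of two nonempty words (they are too long)
  prim-letter : ∀ (z : Fin n) → Prim (ev ((1# , z ∷ []) ∷ []))
  prim-letter z a as b bs =
    sumL-0ᵐ (sh (a ∷ as) (b ∷ bs))
      (λ {w} m → ev-letter-other z w (λ e → too-long (P.trans (P.sym (P.cong length e)) (sh-length (a ∷ as) (b ∷ bs) m))))
    where
      too-long : ¬ (1 ≡ suc (length as ℕ.+ length (b ∷ bs)))
      too-long e with P.trans (P.cong ℕ.pred e) (NP.+-suc (length as) (length bs))
      ... | ()

  p-prim : ∀ k (ℓ' γ : Word) → Prim (pv k ℓ' γ)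
  p-prim k ℓ' [] = Prim-0
  p-prim k ℓ' (a ∷ []) = prim-letter a
  p-prim zero ℓ' (a ∷ b ∷ r) = Prim-0
  p-prim (suc k) ℓ' (a ∷ b ∷ r) with restrict ℓ' (a ∷ b ∷ r)
  ... | [] = Prim-0
  ... | _ ∷ [] = Prim-0
  ... | i₁ ∷ i₂ ∷ _ =
    Prim-resp (λ w → sym (ev-bracket (pFuel F k (restrict ℓ' S) S) (pFuel F k (restrict ℓ' T) T) w))
      (prim-bracket _ _ (p-prim k _ S) (p-prim k _ T))
    where
      γ' = rotateTo i₁ (a ∷ b ∷ r)
      S = takeWhileᵇ (λ i → not (i == i₂)) γ'
      T = dropWhileᵇ (λ i → not (i == i₂)) γ'

Unique-⊆ : ∀ {a} {A : Set a} {xs ys : List A} → xs ⊆ ys → Unique ys → Unique xs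
Unique-⊆ [] u = u
Unique-⊆ (y ∷ʳ s) (_ ∷ u) = Unique-⊆ s u
Unique-⊆ (P.refl ∷ s) (h ∷ u) = ¬Any⇒All¬ _ (λ m → All¬⇒¬Any h (Sublist.lookup s m)) ∷ Unique-⊆ s u

module Letters (n : ℕ) where

  Word : Set
  Word = List (Fin n)

  elem-∈ : ∀ (i : Fin n) xs → elem i xs ≡ true → i ∈ xs
  elem-∈ i (j ∷ xs) e with i Fin.≟ j
  ... | yes p = here p
  ... | no _ = there (elem-∈ i xs e)

  ∈-elem : ∀ (i : Fin n) xs → i ∈ xs → elem i xs ≡ true
  ∈-elem i (j ∷ xs) m with i Fin.≟ j
  ... | yes _ = P.refl
  ∈-elem i (j ∷ xs) (here p) | no np = ⊥-elim (np p)
  ∈-elem i (j ∷ xs) (there m) | no np = ∈-elem i xs m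

  ∉-elem : ∀ (i : Fin n) xs → i ∉ xs → elem i xs ≡ false
  ∉-elem i xs i∉ with elem i xs in e
  ... | true = ⊥-elim (i∉ (elem-∈ i xs e))
  ... | false = P.refl

  ∈-filterᵇ⁺ : ∀ (q : Fin n → Bool) {x} xs → x ∈ xs → q x ≡ true → x ∈ filterᵇ q xs
  ∈-filterᵇ⁺ q xs m e = ∈-filter⁺ (T? ∘ q) m (Equivalence.from T-≡ e)

  ∈-filterᵇ⁻ : ∀ (q : Fin n → Bool) {x} xs → x ∈ filterᵇ q xs → q x ≡ true
  ∈-filterᵇ⁻ q xs m = Equivalence.to T-≡ (proj₂ (∈-filter⁻ (T? ∘ q) {xs = xs} m))

  filterᵇ-⊆ : ∀ (q : Fin n → Bool) xs → filterᵇ q xs ⊆ xs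
  filterᵇ-⊆ q = filter-⊆ (T? ∘ q)

  restrict-⊆ : ∀ (ℓ' γ : Word) → restrict ℓ' γ ⊆ ℓ'
  restrict-⊆ ℓ' γ = filterᵇ-⊆ (λ i → elem i γ) ℓ'

  restrict→word : ∀ (ℓ' γ : Word) {z} → z ∈ restrict ℓ' γ → z ∈ γ
  restrict→word ℓ' γ {z} m = elem-∈ z γ (∈-filterᵇ⁻ (λ i → elem i γ) ℓ' m)

  word→restrict : ∀ (ℓ' γ : Word) {z} → z ∈ ℓ' → z ∈ γ → z ∈ restrict ℓ' γ
  word→restrict ℓ' γ {z} mℓ mγ = ∈-filterᵇ⁺ (λ i → elem i γ) ℓ' mℓ (∈-elem z γ mγ)

  dropWhile-∈ : ∀ (x : Fin n) xs → x ∈ xs → ∃ λ ys → dropWhileᵇ (λ i → not (i == x)) xs ≡ x ∷ ys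
  dropWhile-∈ x (y ∷ xs) m with y Fin.≟ x
  ... | yes P.refl = xs , P.refl
  dropWhile-∈ x (y ∷ xs) (here P.refl) | no ne = ⊥-elim (ne P.refl)
  dropWhile-∈ x (y ∷ xs) (there m) | no ne = dropWhile-∈ x xs m

  takeWhile-∷ : ∀ (x y : Fin n) xs → y ≢ x →
    takeWhileᵇ (λ i → not (i == x)) (y ∷ xs) ≡ y ∷ takeWhileᵇ (λ i → not (i == x)) xs
  takeWhile-∷ x y xs ne with y Fin.≟ x
  ... | yes e = ⊥-elim (ne e)
  ... | no _ = P.refl

  rotateTo-head : ∀ (a : Fin n) xs → rotateTo a (a ∷ xs) ≡ a ∷ xs
  rotateTo-head a xs with a Fin.≟ a
  ... | yes _ = P.cong (a ∷_) (LP.++-identityʳ xs)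
  ... | no ne = ⊥-elim (ne P.refl)

rank : ∀ {n} → List (Fin n) → Fin n → ℕ
rank [] i = 0
rank (j ∷ L) i with j Fin.≟ i
... | yes _ = 0
... | no _ = suc (rank L i)

rank-injective : ∀ {n} (L : List (Fin n)) {i j} → i ∈ L → j ∈ L → rank L i ≡ rank L j → i ≡ j
rank-injective (k ∷ L) {i} {j} mi mj e with k Fin.≟ i | k Fin.≟ j
... | yes p | yes q = P.trans (P.sym p) q
... | yes p | no q = ⊥-elim (NP.0≢1+n e)
... | no p | yes q = ⊥-elim (NP.0≢1+n (P.sym e))
... | no p | no q = rank-injective L (later mi p) (later mj q) (NP.suc-injective e)
  where
    later : ∀ {z} → z ∈ k ∷ L → k ≢ z → z ∈ L
    later (here r) ne = ⊥-elim (ne (P.sym r))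
    later (there m) ne = m

rank-⊆ : ∀ {n} {a : Fin n} {ys L} → (a ∷ ys) ⊆ L → Unique L → ∀ {b} → b ∈ ys → rank L a < rank L b
rank-⊆ {a = a} {ys} {k ∷ L} (.k ∷ʳ s) (h ∷ u) {b} bm with k Fin.≟ a | k Fin.≟ b
... | yes P.refl | _ = ⊥-elim (All¬⇒¬Any h (Sublist.lookup s (here P.refl)))
... | no _ | yes P.refl = ⊥-elim (All¬⇒¬Any h (Sublist.lookup s (there bm)))
... | no _ | no _ = s≤s (rank-⊆ s u bm)
rank-⊆ {a = a} {ys} {.a ∷ L} (P.refl ∷ s) (h ∷ u) {b} bm with a Fin.≟ a | a Fin.≟ b
... | yes _ | yes P.refl = ⊥-elim (All¬⇒¬Any h (Sublist.lookup s bm))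
... | yes _ | no _ = s≤s z≤n
... | no ne | _ = ⊥-elim (ne P.refl)

module _ {a r} {A : Set a} (_<_ : A → A → Set r) (<-trans : ∀ {u v w} → u < v → v < w → u < w)
         (<-tri : ∀ u w → (u < w) ⊎ (u ≡ w) ⊎ (w < u)) where

  greatest : ∀ {b} {B : Set b} (key : B → A) x xs →
    ∃ λ g → g ∈ x ∷ xs × (∀ {y} → y ∈ x ∷ xs → key y ≡ key g ⊎ key y < key g)
  greatest key x [] = x , here P.refl , (λ { (here P.refl) → inj₁ P.refl })
  greatest key x (x' ∷ xs) with greatest key x' xs
  ... | g , g∈ , below with <-tri (key x) (key g)
  ...   | inj₁ lt = g , there g∈ , (λ { (here P.refl) → inj₂ lt ; (there m) → below m })
  ...   | inj₂ (inj₁ e) = g , there g∈ , (λ { (here P.refl) → inj₁ e ; (there m) → below m })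
  ...   | inj₂ (inj₂ gt) = x , here P.refl , below'
    where
      below' : ∀ {y} → y ∈ x ∷ x' ∷ xs → key y ≡ key x ⊎ key y < key x
      below' (here P.refl) = inj₁ P.refl
      below' (there m) with below m
      ... | inj₁ e = inj₂ (P.subst (_< key x) (P.sym e) gt)
      ... | inj₂ lt = inj₂ (<-trans lt gt)

module WordOrder {n : ℕ} (ℓ₀ : List (Fin n)) (all₀ : ∀ i → i ∈ ℓ₀) where

  rk : Fin n → ℕ
  rk = rank ℓ₀

  rk-injective : ∀ {i j} → rk i ≡ rk j → i ≡ j
  rk-injective {i} {j} = rank-injective ℓ₀ (all₀ i) (all₀ j)

  infix 4 _≺_
  data _≺_ : List (Fin n) → List (Fin n) → Set where
    nil : ∀ {y ys} → [] ≺ (y ∷ ys)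
    hd : ∀ {x y xs ys} → rk y < rk x → (x ∷ xs) ≺ (y ∷ ys)
    tl : ∀ {x xs ys} → xs ≺ ys → (x ∷ xs) ≺ (x ∷ ys)

  ≺-irrefl : ∀ {u} → ¬ (u ≺ u)
  ≺-irrefl (hd r) = NP.<-irrefl P.refl r
  ≺-irrefl (tl p) = ≺-irrefl p

  ≺-trans : ∀ {u v w} → u ≺ v → v ≺ w → u ≺ w
  ≺-trans nil (hd _) = nil
  ≺-trans nil (tl _) = nil
  ≺-trans (hd r) (hd s) = hd (NP.<-trans s r)
  ≺-trans (hd r) (tl _) = hd r
  ≺-trans (tl _) (hd s) = hd s
  ≺-trans (tl p) (tl q) = tl (≺-trans p q)

  ≺-asym : ∀ {u w} → u ≺ w → ¬ (w ≺ u)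
  ≺-asym p q = ≺-irrefl (≺-trans p q)

  ≺-tri : ∀ u w → (u ≺ w) ⊎ (u ≡ w) ⊎ (w ≺ u)
  ≺-tri [] [] = inj₂ (inj₁ P.refl)
  ≺-tri [] (y ∷ w) = inj₁ nil
  ≺-tri (x ∷ u) [] = inj₂ (inj₂ nil)
  ≺-tri (x ∷ u) (y ∷ w) with NP.<-cmp (rk x) (rk y)
  ... | tri< r _ _ = inj₂ (inj₂ (hd r))
  ... | tri> _ _ r = inj₁ (hd r)
  ... | tri≈ _ e _ with rk-injective e
  ...   | P.refl with ≺-tri u w
  ...     | inj₁ p = inj₁ (tl p)
  ...     | inj₂ (inj₁ P.refl) = inj₂ (inj₁ P.refl)
  ...     | inj₂ (inj₂ p) = inj₂ (inj₂ (tl p))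

  ≺-++ˡ : ∀ {u S} (v T : List (Fin n)) → u ≺ S → length u ≡ length S → (u ++ v) ≺ (S ++ T)
  ≺-++ˡ v T nil ()
  ≺-++ˡ v T (hd r) e = hd r
  ≺-++ˡ v T (tl p) e = tl (≺-++ˡ v T p (NP.suc-injective e))

  ≺-++ʳ : ∀ (S : List (Fin n)) {v T} → v ≺ T → (S ++ v) ≺ (S ++ T)
  ≺-++ʳ [] p = p
  ≺-++ʳ (x ∷ S) p = tl (≺-++ʳ S p)

  ≺-head : ∀ {x y xs ys} → (x ∷ xs) ≺ (y ∷ ys) → (rk y < rk x) ⊎ (x ≡ y)
  ≺-head (hd r) = inj₁ r
  ≺-head (tl _) = inj₂ P.refl

module Triangularity {c ℓ} (F : Field c ℓ) (n : ℕ) (ℓ₀ : List (Fin n)) (u₀ : Unique ℓ₀) (all₀ : ∀ i → i ∈ ℓ₀) where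
  open FiniteSums F
  open ShuffleSums F {A = Fin n}
  open Primitives F {A = Fin n}
  open Evaluation F n
  open PGammaPrimitive F n
  open Letters n using (∈-elem; restrict-⊆; restrict→word; word→restrict; dropWhile-∈; takeWhile-∷; rotateTo-head)
  open WordOrder ℓ₀ all₀

  _↭?w_ : (u v : Word) → Dec (u ↭ v)
  _↭?w_ = _↭?_ Fin._≟_

  []≁∷ : ∀ {z : Fin n} {T'} → ¬ ([] ↭ (z ∷ T'))
  []≁∷ p with ↭-length p
  ... | ()

  module BracketStep (a : Fin n) (γt S' T' : Word) (i₂ : Fin n)
                     (cat : (a ∷ S') ++ (i₂ ∷ T') ≡ a ∷ γt) (a∉T : a ∉ i₂ ∷ T')
                     (a-first : ∀ {z} → z ∈ γt → rk a < rk z)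
                     (x y : Word → Carrier)
                     (supp-x : ∀ u → ¬ (u ↭ (a ∷ S')) → x u ≈ 0#)
                     (supp-y : ∀ u → ¬ (u ↭ (i₂ ∷ T')) → y u ≈ 0#) where
    S = a ∷ S'
    T = i₂ ∷ T'
    γ = a ∷ γt

    T-after-a : ∀ {z} → z ∈ T → rk a < rk z
    T-after-a {z} m with P.subst (z ∈_) cat (∈-++⁺ʳ S m)
    ... | here P.refl = ⊥-elim (a∉T m)
    ... | there m' = a-first m'

    -- y·x vanishes on every word starting with a, since y lives on words
    -- avoiding a and ranked after a
    yx-vanishes : ∀ w → (γ ≺ w ⊎ γ ≡ w) → mul y x w ≈ 0#
    yx-vanishes w le = Sp-0 w _ (term0 le)
      where
        term0 : (γ ≺ w ⊎ γ ≡ w) → ∀ s t → s ++ t ≡ w → y s * x t ≈ 0#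
        term0 _ [] t e = trans (*-cong (supp-y [] []≁∷) refl) (zeroˡ _)
        term0 le (z ∷ s) t e with (z ∷ s) ↭?w T
        ... | no ns = trans (*-cong (supp-y (z ∷ s) ns) refl) (zeroˡ _)
        ... | yes ps with le
        ...   | inj₂ P.refl = ⊥-elim (a∉T (∈-resp-↭ ps (here (P.sym (LP.∷-injectiveˡ e)))))
        ...   | inj₁ lt with ≺-head (P.subst (γ ≺_) (P.sym e) lt)
        ...     | inj₁ r = ⊥-elim (NP.<-asym r (T-after-a (∈-resp-↭ ps (here P.refl))))
        ...     | inj₂ P.refl = ⊥-elim (a∉T (∈-resp-↭ ps (here P.refl)))

    -- above γ: a factorisation w = s t with x s · y t ≠ 0 would force s ≼ S and
    -- t ≼ T up to rearrangement, hence w ≼ γ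
    tri-step : (∀ u → S ≺ u → x u ≈ 0#) → (∀ u → T ≺ u → y u ≈ 0#) →
               ∀ w → γ ≺ w → mul x y w - mul y x w ≈ 0#
    tri-step tri-x tri-y w lt = trans (+-cong xy0 (-‿cong (yx-vanishes w (inj₁ lt)))) (trans (+-identityˡ _) -0≈0)
      where
        xy0 : mul x y w ≈ 0#
        xy0 = Sp-0 w _ term0
          where
            term0 : ∀ s t → s ++ t ≡ w → x s * y t ≈ 0#
            term0 s t e with ≺-tri S s
            ... | inj₁ p = trans (*-cong (tri-x s p) refl) (zeroˡ _)
            ... | inj₂ (inj₁ P.refl) with ≺-tri T t
            ...   | inj₁ p = trans (*-cong refl (tri-y t p)) (zeroʳ _)
            ...   | inj₂ (inj₁ P.refl) = ⊥-elim (≺-irrefl (P.subst (γ ≺_) (P.trans (P.sym e) cat) lt))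
            ...   | inj₂ (inj₂ p) = ⊥-elim (≺-asym lt (P.subst₂ _≺_ e cat (≺-++ʳ S p)))
            term0 s t e | inj₂ (inj₂ p) with s ↭?w S
            ...   | no ns = trans (*-cong (supp-x s ns) refl) (zeroˡ _)
            ...   | yes ps = ⊥-elim (≺-asym lt (P.subst₂ _≺_ e cat (≺-++ˡ t T p (↭-length ps))))

    -- at γ: only the factorisation γ = S · T contributes
    diag-step : x S ≈ 1# → y T ≈ 1# → mul x y γ - mul y x γ ≈ 1#
    diag-step dS dT =
      trans (+-cong xy1 (-‿cong (yx-vanishes γ (inj₂ P.refl)))) (trans (+-cong refl -0≈0) (+-identityʳ 1#))
      where
        xy1 : mul x y γ ≈ 1#
        xy1 = begin
          Sp γ (λ u v → x u * y v) ≡⟨ P.cong (λ g → Sp g (λ u v → x u * y v)) (P.sym cat) ⟩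
          Sp (S ++ T) (λ u v → x u * y v) ≈⟨ Sp-at S T _ other0 ⟩
          x S * y T ≈⟨ *-cong dS dT ⟩
          1# * 1# ≈⟨ *-identityˡ 1# ⟩
          1# ∎
          where
            other0 : ∀ s t → s ++ t ≡ S ++ T → s ≢ S → x s * y t ≈ 0#
            other0 s t e ne with s ↭?w S
            ... | no ns = trans (*-cong (supp-x s ns) refl) (zeroˡ _)
            ... | yes ps = ⊥-elim (ne (prefix-unique s t S T e (↭-length ps)))

  HeadFirst : Word → Set
  HeadFirst [] = ⊤
  HeadFirst (g ∷ γt) = ∀ {z} → z ∈ γt → rk g < rk z

  -- The invariant preserved by the recursion defining p_γ with reference order ℓ'.
  record Inv (ℓ' γ : Word) : Set where
    field
      uniq : Unique γ
      mem : ∀ {z} → z ∈ γ → z ∈ ℓ'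
      sub : ℓ' ⊆ ℓ₀
      first : HeadFirst γ

  restrict-⊆₀ : ∀ {ℓ' γ} → Inv ℓ' γ → restrict ℓ' γ ⊆ ℓ₀
  restrict-⊆₀ {ℓ'} {γ} inv = Sublist.⊆-trans (restrict-⊆ ℓ' γ) (Inv.sub inv)

  restrict-head : ∀ ℓ' a γt i₁ i₂ rest → Inv ℓ' (a ∷ γt) →
    restrict ℓ' (a ∷ γt) ≡ i₁ ∷ i₂ ∷ rest → i₁ ≡ a
  restrict-head ℓ' a γt i₁ i₂ rest inv eq with i₁ Fin.≟ a
  ... | yes e = e
  ... | no ne = ⊥-elim (NP.<-asym i₁-before-a a-before-i₁)
    where
      a-later : a ∈ i₂ ∷ rest
      a-later with P.subst (a ∈_) eq (word→restrict ℓ' (a ∷ γt) (Inv.mem inv (here P.refl)) (here P.refl))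
      ... | here e = ⊥-elim (ne (P.sym e))
      ... | there m = m
      i₁-before-a : rk i₁ < rk a
      i₁-before-a = rank-⊆ (P.subst (_⊆ ℓ₀) eq (restrict-⊆₀ inv)) u₀ a-later
      a-before-i₁ : rk a < rk i₁
      a-before-i₁ with restrict→word ℓ' (a ∷ γt) (P.subst (i₁ ∈_) (P.sym eq) (here P.refl))
      ... | here e = ⊥-elim (ne e)
      ... | there m = Inv.first inv m

  module Factors (ℓ' : Word) (a : Fin n) (γt S' T' : Word) (i₂ : Fin n) (rest : Word)
                 (inv : Inv ℓ' (a ∷ γt)) (eq : restrict ℓ' (a ∷ γt) ≡ a ∷ i₂ ∷ rest)
                 (cat : (a ∷ S') ++ (i₂ ∷ T') ≡ a ∷ γt) where
    open Inv inv
    Sx = a ∷ S'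
    Tx = i₂ ∷ T'

    unique-γ : Unique (Sx ++ Tx)
    unique-γ = P.subst Unique (P.sym cat) uniq

    a∉T : a ∉ Tx
    a∉T = Unique-++-disjoint Sx unique-γ (here P.refl)

    inS : ∀ {z} → z ∈ Sx → z ∈ a ∷ γt
    inS {z} m = P.subst (z ∈_) cat (∈-++⁺ˡ m)

    inT : ∀ {z} → z ∈ Tx → z ∈ a ∷ γt
    inT {z} m = P.subst (z ∈_) cat (∈-++⁺ʳ Sx m)

    invS : Inv (restrict ℓ' Sx) Sx
    invS = record
      { uniq = Unique-++ˡ Sx unique-γ
      ; mem = λ m → word→restrict ℓ' Sx (mem (inS m)) m
      ; sub = Sublist.⊆-trans (restrict-⊆ ℓ' Sx) sub
      ; first = λ {z} m → first (P.subst (z ∈_) (LP.∷-injectiveʳ cat) (∈-++⁺ˡ m))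
      }

    -- the letters of T' come after i₂ in ℓ₀, as i₂ is the ℓ'-second letter of γ
    i₂-first : ∀ {z} → z ∈ T' → rk i₂ < rk z
    i₂-first {z} m with P.subst (z ∈_) eq (word→restrict ℓ' (a ∷ γt) (mem (inT (there m))) (inT (there m)))
    ... | here P.refl = ⊥-elim (a∉T (there m))
    ... | there (here P.refl) = ⊥-elim (UP.Unique[x∷xs]⇒x∉xs (Unique-++ʳ Sx unique-γ) m)
    ... | there (there zr) = rank-⊆ (∷ˡ⁻ (P.subst (_⊆ ℓ₀) eq (restrict-⊆₀ inv))) u₀ zr

    invT : Inv (restrict ℓ' Tx) Tx
    invT = record
      { uniq = Unique-++ʳ Sx unique-γ
      ; mem = λ m → word→restrict ℓ' Tx (mem (inT m)) m
      ; sub = Sublist.⊆-trans (restrict-⊆ ℓ' Tx) sub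
      ; first = i₂-first
      }

    length-S : suc (length S') ≤ length γt
    length-S = P.subst (suc (length S') ≤_) (P.trans (P.sym (LP.length-++ S')) (P.cong length (LP.∷-injectiveʳ cat)))
                       (P.subst (_≤ length S' ℕ.+ length Tx) (NP.+-comm (length S') 1)
                                (NP.+-monoʳ-≤ (length S') (s≤s z≤n)))

    length-T : length Tx ≤ length γt
    length-T = P.subst (length Tx ≤_) (P.trans (P.sym (LP.length-++ S')) (P.cong length (LP.∷-injectiveʳ cat)))
                       (NP.m≤n+m _ _)

  Unitriangular : ℕ → Word → Word → Set _
  Unitriangular k ℓ' γ = (∀ w → γ ≺ w → pv k ℓ' γ w ≈ 0#) × (γ ≢ [] → pv k ℓ' γ γ ≈ 1#)

  -- the same for the bracket [p_S , p_T], the form p_γ takes after one unfolding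
  BracketUnitriangular : ℕ → Word → Word → Word → Word → Set _
  BracketUnitriangular k ℓ' γ S T =
    (∀ w → γ ≺ w → ev (bracket F (pFuel F k (restrict ℓ' S) S) (pFuel F k (restrict ℓ' T) T)) w ≈ 0#) ×
    (γ ≢ [] → ev (bracket F (pFuel F k (restrict ℓ' S) S) (pFuel F k (restrict ℓ' T) T)) γ ≈ 1#)

  bracket-unitriangular : ∀ k ℓ' a γt i₂ rest S' T' → length γt ≤ k → Inv ℓ' (a ∷ γt) →
    restrict ℓ' (a ∷ γt) ≡ a ∷ i₂ ∷ rest → (a ∷ S') ++ (i₂ ∷ T') ≡ a ∷ γt →
    (∀ ℓ'' γ'' → length γ'' ≤ k → Inv ℓ'' γ'' → Unitriangular k ℓ'' γ'') →
    BracketUnitriangular k ℓ' (a ∷ γt) (a ∷ S') (i₂ ∷ T')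
  bracket-unitriangular k ℓ' a γt i₂ rest S' T' len inv eq cat IH =
    (λ w lt → trans (ev-bracket Pp Qp w) (Step.tri-step (proj₁ resS) (proj₁ resT) w lt)) ,
    (λ _ → trans (ev-bracket Pp Qp (a ∷ γt)) (Step.diag-step (proj₂ resS (λ ())) (proj₂ resT (λ ()))))
    where
      open Factors ℓ' a γt S' T' i₂ rest inv eq cat
      Pp = pFuel F k (restrict ℓ' Sx) Sx
      Qp = pFuel F k (restrict ℓ' Tx) Tx
      resS = IH _ _ (NP.≤-trans length-S len) invS
      resT = IH _ _ (NP.≤-trans length-T len) invT
      module Step = BracketStep a γt S' T' i₂ cat a∉T (Inv.first inv) (ev Pp) (ev Qp)
                                (λ u → p-supp k _ Sx u) (λ u → p-supp k _ Tx u)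

  -- In the recursion, γ is already rotated to start at a, and splitting before
  -- i₂ gives factors a ∷ S' and i₂ ∷ T'.
  split-unitriangular : ∀ k ℓ' a γt i₂ rest → restrict ℓ' (a ∷ γt) ≡ a ∷ i₂ ∷ rest → length γt ≤ k →
    Inv ℓ' (a ∷ γt) → (∀ ℓ'' γ'' → length γ'' ≤ k → Inv ℓ'' γ'' → Unitriangular k ℓ'' γ'') →
    BracketUnitriangular k ℓ' (a ∷ γt) (takeWhileᵇ (λ i → not (i == i₂)) (rotateTo a (a ∷ γt)))
                                       (dropWhileᵇ (λ i → not (i == i₂)) (rotateTo a (a ∷ γt)))
  split-unitriangular k ℓ' a γt i₂ rest eq len inv IH
    with dropWhile-∈ i₂ (a ∷ γt) (restrict→word ℓ' (a ∷ γt) (P.subst (i₂ ∈_) (P.sym eq) (there (here P.refl))))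
  ... | T' , T≡ = P.subst₂ (BracketUnitriangular k ℓ' (a ∷ γt)) (P.sym S≡) (P.sym T≡')
                    (bracket-unitriangular k ℓ' a γt i₂ rest _ T' len inv eq cat IH)
    where
      q = λ i → not (i == i₂)
      a≢i₂ : a ≢ i₂
      a≢i₂ e = UP.Unique[x∷xs]⇒x∉xs (P.subst Unique eq (Unique-⊆ (restrict-⊆₀ inv) u₀)) (here e)
      S≡ : takeWhileᵇ q (rotateTo a (a ∷ γt)) ≡ a ∷ takeWhileᵇ q γt
      S≡ = P.trans (P.cong (takeWhileᵇ q) (rotateTo-head a γt)) (takeWhile-∷ i₂ a γt a≢i₂)
      T≡' : dropWhileᵇ q (rotateTo a (a ∷ γt)) ≡ i₂ ∷ T'
      T≡' = P.trans (P.cong (dropWhileᵇ q) (rotateTo-head a γt)) T≡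
      cat : (a ∷ takeWhileᵇ q γt) ++ (i₂ ∷ T') ≡ a ∷ γt
      cat = P.trans (P.cong₂ _++_ (P.sym S≡) (P.sym T≡'))
                    (P.trans (takeWhile++dropWhile q (rotateTo a (a ∷ γt))) (rotateTo-head a γt))

  unitriangular : ∀ k ℓ' γ → length γ ≤ k → Inv ℓ' γ → Unitriangular k ℓ' γ
  unitriangular k ℓ' [] _ _ = (λ w _ → refl) , (λ ne → ⊥-elim (ne P.refl))
  unitriangular k ℓ' (a ∷ []) _ _ =
    (λ w lt → ev-letter-other a w (λ e → ≺-irrefl (P.subst ((a ∷ []) ≺_) e lt))) , (λ _ → ev-letter-self a)
  unitriangular zero ℓ' (a ∷ b ∷ r) () _
  unitriangular (suc k) ℓ' (a ∷ b ∷ r) (s≤s len) inv with restrict ℓ' (a ∷ b ∷ r) in eq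
  ... | [] = ⊥-elim (¬Any[] (P.subst (a ∈_) eq (word→restrict ℓ' (a ∷ b ∷ r) (Inv.mem inv (here P.refl)) (here P.refl))))
  ... | z ∷ [] = ⊥-elim (a≢b (P.trans (only (P.subst (a ∈_) eq (in-restrict (here P.refl))))
                                      (P.sym (only (P.subst (b ∈_) eq (in-restrict (there (here P.refl))))))))
    where
      in-restrict = λ {z} (m : z ∈ a ∷ b ∷ r) → word→restrict ℓ' (a ∷ b ∷ r) (Inv.mem inv m) m
      only : ∀ {x} → x ∈ z ∷ [] → x ≡ z
      only (here e) = e
      a≢b : a ≢ b
      a≢b e = UP.Unique[x∷xs]⇒x∉xs (Inv.uniq inv) (here e)
  ... | i₁ ∷ i₂ ∷ rest with restrict-head ℓ' a (b ∷ r) i₁ i₂ rest inv eq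
  ...   | P.refl = split-unitriangular k ℓ' a (b ∷ r) i₂ rest eq len inv (unitriangular k)

-- The words in the shuffle a ⧢ b, for a inside S and b outside S, are exactly
-- the words whose restrictions to S and to its complement are a and b, each
-- met once.  Hence the coproduct coefficient Δcoef S x a b is the shuffle sum.

module ShuffleFilter {a} {A : Set a} (S : A → Bool) where

  Sᶜ : A → Bool
  Sᶜ i = not (S i)

  Inside Outside : List A → Set a
  Inside = All (λ i → S i ≡ true)
  Outside = All (λ i → S i ≡ false)

  filter-inside : ∀ w → Inside (filterᵇ S w)
  filter-inside [] = []
  filter-inside (x ∷ w) with S x in e
  ... | true = e ∷ filter-inside w
  ... | false = filter-inside w

  filter-outside : ∀ w → Outside (filterᵇ Sᶜ w)
  filter-outside [] = []
  filter-outside (z ∷ w) with S z in e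
  ... | true = filter-outside w
  ... | false = e ∷ filter-outside w

  filter-∷ : ∀ {z} w → S z ≡ true → filterᵇ S (z ∷ w) ≡ z ∷ filterᵇ S w × filterᵇ Sᶜ (z ∷ w) ≡ filterᵇ Sᶜ w
  filter-∷ w e rewrite e = P.refl , P.refl

  filterᶜ-∷ : ∀ {z} w → S z ≡ false → filterᵇ S (z ∷ w) ≡ filterᵇ S w × filterᵇ Sᶜ (z ∷ w) ≡ z ∷ filterᵇ Sᶜ w
  filterᶜ-∷ w e rewrite e = P.refl , P.refl

  filter-all : ∀ {w} → Inside w → filterᵇ S w ≡ w × filterᵇ Sᶜ w ≡ []
  filter-all [] = P.refl , P.refl
  filter-all {x ∷ w} (e ∷ h) rewrite e = P.cong (x ∷_) (proj₁ (filter-all h)) , proj₂ (filter-all h)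

  filter-none : ∀ {w} → Outside w → filterᵇ S w ≡ [] × filterᵇ Sᶜ w ≡ w
  filter-none [] = P.refl , P.refl
  filter-none {x ∷ w} (e ∷ h) rewrite e = proj₁ (filter-none h) , P.cong (x ∷_) (proj₂ (filter-none h))

  sh-filter : ∀ {a b w} → Inside a → Outside b → w ∈ sh a b → filterᵇ S w ≡ a × filterᵇ Sᶜ w ≡ b
  sh-filter {[]} {b} ta fb (here P.refl) = filter-none fb
  sh-filter {x ∷ a} {[]} ta fb (here P.refl) = filter-all ta
  sh-filter {x ∷ a} {y ∷ b} (ex ∷ ta) (ey ∷ fb) m with ∈-++⁻ (map (x ∷_) (sh a (y ∷ b))) m
  ... | inj₁ m₁ with ∈-map⁻ _ m₁
  ...   | w' , m' , P.refl rewrite ex with sh-filter ta (ey ∷ fb) m'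
  ...     | e₁ , e₂ = P.cong (x ∷_) e₁ , e₂
  sh-filter {x ∷ a} {y ∷ b} (ex ∷ ta) (ey ∷ fb) m | inj₂ m₂ with ∈-map⁻ _ m₂
  ...   | w' , m' , P.refl rewrite ey with sh-filter (ex ∷ ta) fb m'
  ...     | e₁ , e₂ = e₁ , P.cong (y ∷_) e₂

  sh-complete : ∀ w {a b} → filterᵇ S w ≡ a → filterᵇ Sᶜ w ≡ b → w ∈ sh a b
  sh-complete [] P.refl P.refl = here P.refl
  sh-complete (z ∷ w) {a} {b} e₁ e₂ = by-letter (S z) P.refl
    where
      inside : ∀ b → z ∷ filterᵇ S w ≡ a → filterᵇ Sᶜ w ≡ b → (z ∷ w) ∈ sh a b
      inside [] P.refl e₂' with sh-complete w {filterᵇ S w} {[]} P.refl e₂'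
      ... | m rewrite sh-[] (filterᵇ S w) with m
      ...   | here e = here (P.cong (z ∷_) e)
      inside (y ∷ b) P.refl e₂' = ∈-++⁺ˡ (∈-map⁺ (z ∷_) (sh-complete w P.refl e₂'))

      outside : ∀ a → filterᵇ S w ≡ a → z ∷ filterᵇ Sᶜ w ≡ b → (z ∷ w) ∈ sh a b
      outside [] e₁' P.refl with sh-complete w {[]} {filterᵇ Sᶜ w} e₁' P.refl
      ... | here e = here (P.cong (z ∷_) e)
      outside (x ∷ a) e₁' P.refl =
        ∈-++⁺ʳ (map (x ∷_) (sh a (z ∷ filterᵇ Sᶜ w))) (∈-map⁺ (z ∷_) (sh-complete w e₁' P.refl))

      by-letter : ∀ s → S z ≡ s → (z ∷ w) ∈ sh a b
      by-letter true ez = inside b (P.trans (P.sym (proj₁ (filter-∷ w ez))) e₁) (P.trans (P.sym (proj₂ (filter-∷ w ez))) e₂)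
      by-letter false ez = outside a (P.trans (P.sym (proj₁ (filterᶜ-∷ w ez))) e₁) (P.trans (P.sym (proj₂ (filterᶜ-∷ w ez))) e₂)

  Unique-sh : ∀ {a b} → Inside a → Outside b → Unique (sh a b)
  Unique-sh {[]} ta fb = [] ∷ []
  Unique-sh {x ∷ a} {[]} ta fb = [] ∷ []
  Unique-sh {x ∷ a} {y ∷ b} (ex ∷ ta) (ey ∷ fb) =
    UP.++⁺ (UP.map⁺ LP.∷-injectiveʳ (Unique-sh ta (ey ∷ fb))) (UP.map⁺ LP.∷-injectiveʳ (Unique-sh (ex ∷ ta) fb)) disjoint
    where
      disjoint : ∀ {v} → ¬ (v ∈ map (x ∷_) (sh a (y ∷ b)) × v ∈ map (y ∷_) (sh (x ∷ a) b))
      disjoint (m₁ , m₂) with ∈-map⁻ _ m₁ | ∈-map⁻ _ m₂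
      ... | _ , _ , P.refl | _ , _ , e with P.trans (P.sym ex) (P.subst (λ z → S z ≡ false) (P.sym (LP.∷-injectiveˡ e)) ey)
      ... | ()

module Coproduct {c ℓ} (F : Field c ℓ) (n : ℕ) where
  open FiniteSums F
  open ShuffleSums F {A = Fin n}
  open Evaluation F n using (Word; ≟w-yes; ≟w-no)

  gate : Bool → Bool → Carrier → Carrier
  gate b₁ b₂ v = if b₁ then (if b₂ then v else 0#) else 0#

  gate-+ : ∀ b₁ b₂ u v → gate b₁ b₂ (u + v) ≈ gate b₁ b₂ u + gate b₁ b₂ v
  gate-+ true true u v = refl
  gate-+ true false u v = sym (+-identityˡ 0#)
  gate-+ false b₂ u v = sym (+-identityˡ 0#)

  gate-* : ∀ b₁ b₂ k v → gate b₁ b₂ (k * v) ≈ k * gate b₁ b₂ v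
  gate-* true true k v = refl
  gate-* true false k v = sym (zeroʳ k)
  gate-* false b₂ k v = sym (zeroʳ k)

  gate-cong : ∀ b₁ b₂ {u v} → u ≈ v → gate b₁ b₂ u ≈ gate b₁ b₂ v
  gate-cong true true e = e
  gate-cong true false e = refl
  gate-cong false b₂ e = refl

  gate-closed₁ : ∀ {b₁} b₂ v → b₁ ≡ false → gate b₁ b₂ v ≈ 0#
  gate-closed₁ b₂ v P.refl = refl

  gate-closed₂ : ∀ b₁ {b₂} v → b₂ ≡ false → gate b₁ b₂ v ≈ 0#
  gate-closed₂ false v P.refl = refl
  gate-closed₂ true v P.refl = refl

  gate-open : ∀ {b₁ b₂} v → b₁ ≡ true → b₂ ≡ true → gate b₁ b₂ v ≈ v
  gate-open v P.refl P.refl = refl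

  left-ok right-ok : (Fin n → Bool) → Word → Word → Bool
  left-ok S a w = restrictᵖ w S ≟w a
  right-ok S b w = restrictᵖ w (λ i → not (S i)) ≟w b

  Δ-term : (Fin n → Bool) → (Word → Carrier) → Word → Word → Word → Carrier
  Δ-term S x a b w = gate (left-ok S a w) (right-ok S b w) (x w)

  Δcoef-+ : ∀ S (x y : Word → Carrier) a b → Δcoef F S (λ w → x w + y w) a b ≈ Δcoef F S x a b + Δcoef F S y a b
  Δcoef-+ S x y a b = trans (sumL-cong (perms (allFin n)) (λ w → gate-+ (left-ok S a w) (right-ok S b w) (x w) (y w))) (sumL-+ (perms (allFin n)) _ _)

  Δcoef-* : ∀ S k (x : Word → Carrier) a b → Δcoef F S (λ w → k * x w) a b ≈ k * Δcoef F S x a b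
  Δcoef-* S k x a b = trans (sumL-cong (perms (allFin n)) (λ w → gate-* (left-ok S a w) (right-ok S b w) k (x w))) (sumL-*ˡ (perms (allFin n)) k _)

  Δcoef-cong : ∀ S {x y : Word → Carrier} a b → (∀ w → x w ≈ y w) → Δcoef F S x a b ≈ Δcoef F S y a b
  Δcoef-cong S a b e = sumL-cong (perms (allFin n)) (λ w → gate-cong (left-ok S a w) (right-ok S b w) (e w))

  Δcoef-inside : ∀ S (x : Word → Carrier) a b → ¬ ShuffleFilter.Inside S a → Δcoef F S x a b ≈ 0#
  Δcoef-inside S x a b a⊈S = sumL-0 (perms (allFin n)) (λ w → gate-closed₁ (right-ok S b w) (x w)
    (≟w-no (λ e → a⊈S (P.subst (ShuffleFilter.Inside S) e (ShuffleFilter.filter-inside S w)))))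

  Δcoef-outside : ∀ S (x : Word → Carrier) a b → ¬ ShuffleFilter.Outside S b → Δcoef F S x a b ≈ 0#
  Δcoef-outside S x a b b⊈Sᶜ = sumL-0 (perms (allFin n)) (λ w → gate-closed₂ (left-ok S a w) (x w)
    (≟w-no (λ e → b⊈Sᶜ (P.subst (ShuffleFilter.Outside S) e (ShuffleFilter.filter-outside S w)))))

  Δcoef≈Sh : ∀ S (x : Word → Carrier) → InL F x → ∀ a b →
    ShuffleFilter.Inside S a → ShuffleFilter.Outside S b → Δcoef F S x a b ≈ Sh a b x
  Δcoef≈Sh S x x∈L a b ta fb =
    sumL-reindex (perms (allFin n)) (sh a b) (Δ-term S x a b) x
      (Unique-perms Fin._≟_ (allFin n) (UP.allFin⁺ n)) (Unique-sh ta fb) matched unmatched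
    where
      open ShuffleFilter S
      matched : ∀ {w} → w ∈ perms (allFin n) →
        (w ∈ sh a b × Δ-term S x a b w ≈ x w) ⊎ (w ∉ sh a b × Δ-term S x a b w ≈ 0#)
      matched {w} _ = decide (LP.≡-dec Fin._≟_ (filterᵇ S w) a) (LP.≡-dec Fin._≟_ (filterᵇ Sᶜ w) b)
        where
          decide : Dec (filterᵇ S w ≡ a) → Dec (filterᵇ Sᶜ w ≡ b) →
            (w ∈ sh a b × Δ-term S x a b w ≈ x w) ⊎ (w ∉ sh a b × Δ-term S x a b w ≈ 0#)
          decide (no ne₁) _ = inj₂ ((λ m → ne₁ (proj₁ (sh-filter ta fb m))) , gate-closed₁ (right-ok S b w) (x w) (≟w-no ne₁))
          decide (yes _) (no ne₂) = inj₂ ((λ m → ne₂ (proj₂ (sh-filter ta fb m))) , gate-closed₂ (left-ok S a w) (x w) (≟w-no ne₂))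
          decide (yes e₁) (yes e₂) = inj₁ (sh-complete w e₁ e₂ , gate-open (x w) (≟w-yes e₁) (≟w-yes e₂))
      unmatched : ∀ {w} → w ∈ sh a b → w ∉ perms (allFin n) → x w ≈ 0#
      unmatched {w} _ w∉ = x∈L w (λ p → w∉ (perms-complete (allFin n) p))

module LieElements {c ℓ} (F : Field c ℓ) (n : ℕ) where
  open FiniteSums F
  open ShuffleSums F {A = Fin n}
  open Primitives F {A = Fin n}
  open Evaluation F n using (Word)
  open PGammaPrimitive F n
  open Coproduct F n
  open Letters n using (elem-∈; ∈-elem; ∉-elem)

  -- the trivial splittings (S or T empty) contribute x itself, which vanishes
  -- off L[I]; the proper ones are the shuffle sums killed by primitivity
  Lie-from-Prim : ∀ (x : Word → Carrier) → InL F x → Prim x → IsLie F x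
  Lie-from-Prim x x∈L px = x∈L , Δ0
    where
      Δ0 : ∀ (S : Fin n → Bool) → ∃ (λ i → S i ≡ true) → ∃ (λ i → S i ≡ false) → ∀ a b → Δcoef F S x a b ≈ 0#
      Δ0 S (i , i∈S) (j , j∉S) a b
        with All.all? (λ z → S z Bool.≟ true) a | All.all? (λ z → S z Bool.≟ false) b
      ... | no a⊈S | _ = Δcoef-inside S x a b a⊈S
      ... | yes _ | no b⊈Sᶜ = Δcoef-outside S x a b b⊈Sᶜ
      ... | yes ta | yes fb = trans (Δcoef≈Sh S x x∈L a b ta fb) (shuffles a b ta fb)
        where
          not-a-permutation : ∀ {k} → S k ≡ true → S k ≡ false → ⊥
          not-a-permutation e e' with P.trans (P.sym e) e'
          ... | ()
          shuffles : ∀ a b → ShuffleFilter.Inside S a → ShuffleFilter.Outside S b → Sh a b x ≈ 0#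
          shuffles [] b ta fb = trans (Sh-[]ˡ b x)
            (x∈L b (λ p → not-a-permutation i∈S (All.lookup fb (∈-resp-↭ (↭-sym p) (∈-allFin i)))))
          shuffles (a' ∷ as) [] ta fb = trans (Sh-[]ʳ (a' ∷ as) x)
            (x∈L (a' ∷ as) (λ p → not-a-permutation (All.lookup ta (∈-resp-↭ (↭-sym p) (∈-allFin j))) j∉S))
          shuffles (a' ∷ as) (b' ∷ bs) ta fb = px a' as b' bs

  p-Lie : ∀ k (ℓ' γ : Word) → γ ↭ allFin n → IsLie F (pv k ℓ' γ)
  p-Lie k ℓ' γ γ↭I = Lie-from-Prim _ (λ w w≁I → p-supp k ℓ' γ w (λ w↭γ → w≁I (↭-trans w↭γ γ↭I))) (p-prim k ℓ' γ)

  Lie-+ : ∀ {x y} → IsLie F x → IsLie F y → IsLie F (λ w → x w + y w)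
  Lie-+ {x} {y} (ix , dx) (iy , dy) =
    (λ w nw → trans (+-cong (ix w nw) (iy w nw)) (+-identityˡ 0#)) ,
    (λ S t f a b → trans (Δcoef-+ S x y a b) (trans (+-cong (dx S t f a b) (dy S t f a b)) (+-identityˡ 0#)))

  Lie-* : ∀ k {x} → IsLie F x → IsLie F (λ w → k * x w)
  Lie-* k {x} (ix , dx) =
    (λ w nw → trans (*-cong refl (ix w nw)) (zeroʳ k)) ,
    (λ S t f a b → trans (Δcoef-* S k x a b) (trans (*-cong refl (dx S t f a b)) (zeroʳ k)))

  Lie-cong : ∀ {x y} → (∀ w → x w ≈ y w) → IsLie F x → IsLie F y
  Lie-cong {x} {y} e (ix , dx) =
    (λ w nw → trans (sym (e w)) (ix w nw)) , (λ S t f a b → trans (sym (Δcoef-cong S a b e)) (dx S t f a b))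

  Lie-neg : ∀ {x} → IsLie F x → IsLie F (λ w → - x w)
  Lie-neg {x} lx = Lie-cong (λ w → trans (sym (-‿distribˡ-* 1# (x w))) (-‿cong (*-identityˡ (x w)))) (Lie-* (- 1#) lx)
    where open RingProperties ring using (-‿distribˡ-*)

  Lie-0 : IsLie F (λ _ → 0#)
  Lie-0 = Lie-from-Prim (λ _ → 0#) (λ _ _ → refl) Prim-0

  Lie-combo : ∀ (ℓ₀ : Word) (cs : List (Carrier × Word)) →
    All (λ cγ → IsLie F (p F ℓ₀ (proj₂ cγ))) cs → IsLie F (combo F ℓ₀ cs)
  Lie-combo ℓ₀ [] [] = Lie-0
  Lie-combo ℓ₀ ((k , γ) ∷ cs) (h ∷ hs) = Lie-+ (Lie-* k h) (Lie-combo ℓ₀ cs hs)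

  Sh-first-occurrence : ∀ (u : Word) c v (f : Word → Carrier) → c ∉ u →
    (∀ u' v' → length u' < length u → c ∉ u' → f (u' ++ c ∷ v') ≈ 0#) → Sh u (c ∷ v) f ≈ f (u ++ c ∷ v)
  Sh-first-occurrence [] c v f c∉ h = Sh-[]ˡ (c ∷ v) f
  Sh-first-occurrence (x ∷ u) c v f c∉ h =
    trans (Sh-∷∷ x u c v f)
      (trans (+-cong (Sh-first-occurrence u c v (f ∘ (x ∷_)) (c∉ ∘ there)
                       (λ u' v' lt c∉u' → h (x ∷ u') v' (s≤s lt) (λ { (here e) → c∉ (here e) ; (there m) → c∉u' m })))
                     (sumL-0 (sh (x ∷ u) v) (λ w → h [] w (s≤s z≤n) (λ ()))))
             (+-identityʳ _))

  first-occurrence : ∀ (c : Fin n) w → c ∈ w → ∃ λ u → ∃ λ v → w ≡ u ++ c ∷ v × c ∉ u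
  first-occurrence c (z ∷ w) m with z Fin.≟ c
  ... | yes P.refl = [] , w , P.refl , (λ ())
  first-occurrence c (z ∷ w) (here e) | no ne = ⊥-elim (ne (P.sym e))
  first-occurrence c (z ∷ w) (there m) | no ne with first-occurrence c w m
  ... | u , v , P.refl , c∉u = z ∷ u , v , P.refl , (λ { (here e) → ne (P.sym e) ; (there m') → c∉u m' })

  module _ (i₁ : Fin n) (y : Word → Carrier) (y-Lie : IsLie F y) (y-i₁ : ∀ v → y (i₁ ∷ v) ≈ 0#) where

    shuffle-vanishes : ∀ x u v → (x ∷ u) ++ i₁ ∷ v ↭ allFin n → Sh (x ∷ u) (i₁ ∷ v) y ≈ 0#
    shuffle-vanishes x u v p =
      trans (sym (Δcoef≈Sh S y (proj₁ y-Lie) (x ∷ u) (i₁ ∷ v) inside outside))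
            (proj₂ y-Lie S (x , ∈-elem x (x ∷ u) (here P.refl)) (i₁ , ∉-elem i₁ (x ∷ u) i₁∉) (x ∷ u) (i₁ ∷ v))
      where
        S = λ i → elem i (x ∷ u)
        unique : Unique ((x ∷ u) ++ i₁ ∷ v)
        unique = Unique-resp-↭ (↭-sym p) (UP.allFin⁺ n)
        i₁∉ : i₁ ∉ x ∷ u
        i₁∉ m = Unique-++-disjoint (x ∷ u) unique m (here P.refl)
        inside : ShuffleFilter.Inside S (x ∷ u)
        inside = All.tabulate (λ {z} m → ∈-elem z (x ∷ u) m)
        outside : ShuffleFilter.Outside S (i₁ ∷ v)
        outside = All.tabulate (λ {z} m → ∉-elem z (x ∷ u) (λ m' → Unique-++-disjoint (x ∷ u) unique m' m))

    vanishes-before : ∀ N u v → length u ≤ N → i₁ ∉ u → y (u ++ i₁ ∷ v) ≈ 0#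
    vanishes-before N [] v len i₁∉ = y-i₁ v
    vanishes-before (suc N) (x ∷ u) v (s≤s len) i₁∉ with _↭?_ Fin._≟_ ((x ∷ u) ++ i₁ ∷ v) (allFin n)
    ... | no np = proj₁ y-Lie _ np
    ... | yes pp = trans (sym (Sh-first-occurrence (x ∷ u) i₁ v y i₁∉
                           (λ u' v' lt i₁∉u' → vanishes-before N u' v' (NP.≤-trans (NP.≤-pred lt) len) i₁∉u')))
                         (shuffle-vanishes x u v pp)

    Lie-vanishing : ∀ w → y w ≈ 0#
    Lie-vanishing w with _↭?_ Fin._≟_ w (allFin n)
    ... | no np = proj₁ y-Lie w np
    ... | yes pp with first-occurrence i₁ w (∈-resp-↭ (↭-sym pp) (∈-allFin i₁))
    ...   | u , v , P.refl , i₁∉u = vanishes-before (length u) u v NP.≤-refl i₁∉u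

module Basis {c ℓ} (F : Field c ℓ) (m : ℕ) (i₁ : Fin (suc m)) (ℓt : List (Fin (suc m)))
             (ℓ₀↭I : (i₁ ∷ ℓt) ↭ allFin (suc m)) where
  open FiniteSums F
  open Evaluation F (suc m) using (Word)
  open LieElements F (suc m)

  ℓ₀ : Word
  ℓ₀ = i₁ ∷ ℓt

  unique₀ : Unique ℓ₀
  unique₀ = Unique-resp-↭ (↭-sym ℓ₀↭I) (UP.allFin⁺ (suc m))

  all₀ : ∀ i → i ∈ ℓ₀
  all₀ i = ∈-resp-↭ (↭-sym ℓ₀↭I) (∈-allFin i)

  open WordOrder ℓ₀ all₀
  open Triangularity F (suc m) ℓ₀ unique₀ all₀

  CR : Word → Set
  CR = CycRep F ℓ₀

  CRp : Carrier × Word → Set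
  CRp cγ = CR (proj₂ cγ)

  cyc-head : ∀ {γ} → CR γ → ∃ λ γt → γ ≡ i₁ ∷ γt
  cyc-head {x ∷ γt} (_ , e) with LP.∷-injective e
  ... | P.refl , _ = γt , P.refl

  -- a representative i₁ ∷ γt satisfies the invariant of the recursion: i₁ has rank 0
  cyc-inv : ∀ γt → (i₁ ∷ γt) ↭ allFin (suc m) → Inv ℓ₀ (i₁ ∷ γt)
  cyc-inv γt p = record
    { uniq = unique
    ; mem = λ {z} _ → all₀ z
    ; sub = Sublist.⊆-refl
    ; first = λ {z} z∈ → i₁-first (λ { P.refl → UP.Unique[x∷xs]⇒x∉xs unique z∈ })
    }
    where
      unique = Unique-resp-↭ (↭-sym p) (UP.allFin⁺ (suc m))
      i₁-first : ∀ {z} → z ≢ i₁ → rk i₁ < rk z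
      i₁-first {z} ne with i₁ Fin.≟ i₁ | i₁ Fin.≟ z
      ... | no ne' | _ = ⊥-elim (ne' P.refl)
      ... | yes _ | yes e = ⊥-elim (ne (P.sym e))
      ... | yes _ | no _ = s≤s z≤n

  p-unitriangular : ∀ γ → CR γ → Unitriangular (length γ) ℓ₀ γ
  p-unitriangular γ cr with cyc-head cr
  ... | γt , P.refl = unitriangular (length (i₁ ∷ γt)) ℓ₀ (i₁ ∷ γt) NP.≤-refl (cyc-inv γt (proj₁ cr))

  p-above : ∀ γ → CR γ → ∀ w → γ ≺ w → p F ℓ₀ γ w ≈ 0#
  p-above γ cr = proj₁ (p-unitriangular γ cr)

  p-diagonal : ∀ γ → CR γ → p F ℓ₀ γ γ ≈ 1#
  p-diagonal γ cr with cyc-head cr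
  ... | γt , P.refl = proj₂ (p-unitriangular _ cr) (λ ())

  p-is-Lie : ∀ γ → CR γ → IsLie F (p F ℓ₀ γ)
  p-is-Lie γ cr = p-Lie (length γ) ℓ₀ γ (proj₁ cr)

  -- Linear independence.  Take the term (k , γ) with the ≺-greatest γ: every
  -- other term vanishes at γ, so evaluating at γ gives k = 0; then drop it.
  combo-shift : ∀ as k γ bs w → combo F ℓ₀ (as ++ (k , γ) ∷ bs) w ≈ k * p F ℓ₀ γ w + combo F ℓ₀ (as ++ bs) w
  combo-shift as k γ bs w = sumL-↭ (λ cγ → proj₁ cγ * p F ℓ₀ (proj₂ cγ) w) (shift (k , γ) as bs)

  top-coefficient : ∀ as k γ bs → CR γ → All CRp (as ++ bs) → γ ∉ map proj₂ (as ++ bs) →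
    (∀ {y} → y ∈ as ++ bs → proj₂ y ≡ γ ⊎ proj₂ y ≺ γ) →
    combo F ℓ₀ (as ++ (k , γ) ∷ bs) γ ≈ 0# → k ≈ 0#
  top-coefficient as k γ bs crγ cr-rest γ∉ below vanish = begin
    k                                        ≈⟨ sym (*-identityʳ k) ⟩
    k * 1#                                   ≈⟨ *-cong refl (sym (p-diagonal γ crγ)) ⟩
    k * p F ℓ₀ γ γ                           ≈⟨ sym (+-identityʳ _) ⟩
    k * p F ℓ₀ γ γ + 0#                      ≈⟨ +-cong refl (sym rest0) ⟩
    k * p F ℓ₀ γ γ + combo F ℓ₀ (as ++ bs) γ ≈⟨ sym (combo-shift as k γ bs γ) ⟩
    combo F ℓ₀ (as ++ (k , γ) ∷ bs) γ        ≈⟨ vanish ⟩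
    0# ∎
    where
      rest0 : combo F ℓ₀ (as ++ bs) γ ≈ 0#
      rest0 = sumL-0ᵐ (as ++ bs) term0
        where
          term0 : ∀ {y} → y ∈ as ++ bs → proj₁ y * p F ℓ₀ (proj₂ y) γ ≈ 0#
          term0 {y} m with below m
          ... | inj₁ e = ⊥-elim (γ∉ (P.subst (_∈ map proj₂ (as ++ bs)) e (∈-map⁺ proj₂ m)))
          ... | inj₂ lt = trans (*-cong refl (p-above (proj₂ y) (All.lookup cr-rest m) γ lt)) (zeroʳ _)

  independent : ∀ N cs → length cs ≤ N → All CRp cs → Unique (map proj₂ cs) →
    (∀ w → combo F ℓ₀ cs w ≈ 0#) → All (λ cγ → proj₁ cγ ≈ 0#) cs
  independent N [] _ _ _ _ = []
  independent (suc N) (x ∷ xs) len cr uq vanish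
    with greatest _≺_ ≺-trans ≺-tri proj₂ x xs
  ... | (k , γ) , top∈ , below with ∈-∃++ top∈
  ...   | as , bs , eq = P.subst (All (λ cγ → proj₁ cγ ≈ 0#)) (P.sym eq)
                           (All-resp-↭ (↭-sym (shift (k , γ) as bs)) (k≈0 ∷ independent N (as ++ bs) len' cr' uq' vanish'))
    where
      cs = as ++ (k , γ) ∷ bs
      cr-shifted : All CRp ((k , γ) ∷ as ++ bs)
      cr-shifted = All-resp-↭ (shift (k , γ) as bs) (P.subst (All CRp) eq cr)
      cr' = All.tail cr-shifted
      without-γ = Unique-delete (map proj₂ as) (P.subst Unique (P.trans (P.cong (map proj₂) eq) (LP.map-++ proj₂ as _)) uq)
      uq' : Unique (map proj₂ (as ++ bs))
      uq' = P.subst Unique (P.sym (LP.map-++ proj₂ as bs)) (proj₁ without-γ)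
      γ∉ : γ ∉ map proj₂ (as ++ bs)
      γ∉ m = proj₂ without-γ (P.subst (γ ∈_) (LP.map-++ proj₂ as bs) m)
      len' : length (as ++ bs) ≤ N
      len' = NP.≤-pred (P.subst (_≤ suc N) (P.trans (P.cong length eq) (↭-length (shift (k , γ) as bs))) len)
      vanish-cs : ∀ w → combo F ℓ₀ cs w ≈ 0#
      vanish-cs w = P.subst (λ l → combo F ℓ₀ l w ≈ 0#) eq (vanish w)
      k≈0 : k ≈ 0#
      k≈0 = top-coefficient as k γ bs (All.head cr-shifted) cr' γ∉
              (λ m → below (P.subst (_ ∈_) (P.sym eq) (∈-delete⁺ as m))) (vanish-cs γ)
      vanish' : ∀ w → combo F ℓ₀ (as ++ bs) w ≈ 0#
      vanish' w = begin
        combo F ℓ₀ (as ++ bs) w                      ≈⟨ sym (+-identityˡ _) ⟩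
        0# + combo F ℓ₀ (as ++ bs) w                 ≈⟨ +-cong (sym (trans (*-cong k≈0 refl) (zeroˡ _))) refl ⟩
        k * p F ℓ₀ γ w + combo F ℓ₀ (as ++ bs) w     ≈⟨ sym (combo-shift as k γ bs w) ⟩
        combo F ℓ₀ cs w                              ≈⟨ vanish-cs w ⟩
        0# ∎

  -- Any x can be matched on a finite set Gs of representatives by a
  -- combination of the p_γ, γ ∈ Gs: fit the others, then correct with the
  -- ≺-least γ ∈ Gs, whose p_γ is 1 at γ and vanishes at all other elements of Gs.
  cancel : ∀ a b → (a - b) + b ≈ a
  cancel a b = trans (+-assoc a (- b) b) (trans (+-cong refl (-‿inverseˡ b)) (+-identityʳ a))

  fit : ∀ N (Gs : List Word) → length Gs ≤ N → All CR Gs → (x : Word → Carrier) →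
    ∃ λ cs → All CRp cs × (∀ {w} → w ∈ Gs → x w ≈ combo F ℓ₀ cs w)
  fit N [] _ _ x = [] , [] , (λ ())
  fit (suc N) (g ∷ gs) len cr x with greatest (λ u w → w ≺ u) (λ p q → ≺-trans q p) flip-tri (λ w → w) g gs
    where
      flip-tri : ∀ u w → (w ≺ u) ⊎ (u ≡ w) ⊎ (u ≺ w)
      flip-tri u w with ≺-tri u w
      ... | inj₁ lt = inj₂ (inj₂ lt)
      ... | inj₂ (inj₁ e) = inj₂ (inj₁ e)
      ... | inj₂ (inj₂ gt) = inj₁ gt
  ... | γ , γ∈ , above with fit N (filter (λ w → ¬? (w ≟W γ)) (g ∷ gs)) len' cr' x
    where
      _≟W_ = LP.≡-dec Fin._≟_
      len' = NP.≤-pred (NP.≤-trans (LP.filter-notAll (λ w → ¬? (w ≟W γ)) (g ∷ gs) (Any.map (λ { P.refl ne → ne P.refl }) γ∈)) len)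
      cr' = All.tabulate (λ m → All.lookup cr (proj₁ (∈-filter⁻ (λ w → ¬? (w ≟W γ)) m)))
  ... | cs' , cr-cs' , fits' = ((k , γ) ∷ cs') , (crγ ∷ cr-cs') , fits
    where
      crγ = All.lookup cr γ∈
      k = x γ - combo F ℓ₀ cs' γ
      fits : ∀ {w} → w ∈ g ∷ gs → x w ≈ combo F ℓ₀ ((k , γ) ∷ cs') w
      fits {w} m with LP.≡-dec Fin._≟_ w γ
      ... | yes P.refl = sym (trans (+-cong (trans (*-cong refl (p-diagonal γ crγ)) (*-identityʳ k)) refl)
                                    (cancel (x γ) (combo F ℓ₀ cs' γ)))
      ... | no ne with above m
      ...   | inj₁ e = ⊥-elim (ne e)
      ...   | inj₂ lt = trans (fits' (∈-filter⁺ (λ w → ¬? (LP.≡-dec Fin._≟_ w γ)) m ne))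
                              (sym (trans (+-cong (trans (*-cong refl (p-above γ crγ w lt)) (zeroʳ k)) refl) (+-identityˡ _)))

  representatives : List Word
  representatives = map (i₁ ∷_) (perms ℓt)

  representatives-CR : All CR representatives
  representatives-CR = All.tabulate is-rep
    where
      is-rep : ∀ {g} → g ∈ representatives → CR g
      is-rep m with ∈-map⁻ (i₁ ∷_) m
      ... | v , v∈ , P.refl = ↭-trans (Perm.prep i₁ (perms-sound ℓt v∈)) ℓ₀↭I , P.refl

  -- Spanning.  Fit x on all representatives; the remainder is a Lie element
  -- vanishing on every word starting with i₁, hence zero.
  spanning : ∀ x → IsLie F x → ∃ λ cs → All CRp cs × (∀ w → x w ≈ combo F ℓ₀ cs w)
  spanning x x-Lie with fit (length representatives) representatives NP.≤-refl representatives-CR x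
  ... | cs , cr , fits = cs , cr , λ w → begin
    x w                                      ≈⟨ sym (cancel (x w) (combo F ℓ₀ cs w)) ⟩
    (x w - combo F ℓ₀ cs w) + combo F ℓ₀ cs w ≈⟨ +-cong (Lie-vanishing i₁ r r-Lie r-i₁ w) refl ⟩
    0# + combo F ℓ₀ cs w                     ≈⟨ +-identityˡ _ ⟩
    combo F ℓ₀ cs w ∎
    where
      r = λ w → x w - combo F ℓ₀ cs w
      r-Lie : IsLie F r
      r-Lie = Lie-+ x-Lie (Lie-neg (Lie-combo ℓ₀ cs (All.map (λ {cγ} → p-is-Lie (proj₂ cγ)) cr)))
      r-i₁ : ∀ v → r (i₁ ∷ v) ≈ 0#
      r-i₁ v with _↭?_ Fin._≟_ (i₁ ∷ v) (allFin (suc m))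
      ... | no np = proj₁ r-Lie _ np
      ... | yes pp = trans (+-cong (fits (∈-map⁺ (i₁ ∷_) (perms-complete ℓt (drop-∷ (↭-trans pp (↭-sym ℓ₀↭I)))))) refl)
                           (-‿inverseʳ _)

proposition5p5 : ∀ {c ℓ : Level} (F : Field c ℓ) → CharZero F →
    ∀ (m : ℕ) (ℓ₀ : List (Fin (suc m))) → ℓ₀ ↭ allFin (suc m) →
    IsBasisOfLie F ℓ₀
proposition5p5 F _ m [] ℓ₀↭I with ↭-length ℓ₀↭I
... | ()
proposition5p5 F _ m (i₁ ∷ ℓt) ℓ₀↭I =
  p-is-Lie , (λ cs → independent (length cs) cs NP.≤-refl) , spanning
  where open Basis F m i₁ ℓt ℓ₀↭I
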